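{- For $i=1,2$ let $\mathscr{L}_i$ be a language and $\mathfrak{M}_i$ a uniquely listable $\mathscr{L}_i$-structure with domain $M_i$. Suppose $\mathfrak{M}_2$ has the DPRM property and that there are p.e. interpretations $\theta_1:\mathfrak{M}_1\dashrightarrow\mathfrak{M}_2$ and $\theta_2:\mathfrak{M}_2\dashrightarrow\mathfrak{M}_1$ of ranks $r_1,r_2$. Let $\zeta=\theta_2\bullet\theta_1:\mathfrak{M}_1\dashrightarrow\mathfrak{M}_1$ and $r=r_1r_2$. The following are equivalent: (i) $(\theta_1,\theta_2)$ is a p.e. bi-interpretation between $\mathfrak{M}_1$ and $\mathfrak{M}_2$; (ii) $\Gamma(\zeta)\subseteq M_1^{r+1}$ is p.e. $\mathscr{L}_1$-definable over $\mathfrak{M}_1$; (iii) $\mathfrak{M}_1$ has the DPRM property.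
   Context: All languages contain $=$, interpreted as equality. Listable means recursively enumerable. For $\rho:A\to B$ and $S\subseteq B^r$, $\rho^{(r)}$ is the coordinatewise map $A^r\to B^r$ and $\rho^*(S)=(\rho^{(r)})^{ -1}(S)$. A listable presentation of an $\mathscr{L}$-structure $\mathfrak{M}$ (domain $M$) is a surjection $\rho:\mathbb{N}\to M$ with $\rho^*(s^{\mathfrak{M}})$ listable for every symbol $s$ (function symbols via graphs); $X\subseteq M^r$ is totally listable if $\rho^*(X)$ is listable for all listable presentations $\rho$. Presentations $\rho,\gamma$ are equivalent if $\gamma=\rho\circ\phi$ for a total recursive $\phi$; uniquely listable means a listable presentation exists and all are equivalent. P.e. formulas use only atomic formulas, $\wedge,\vee,\exists$; definable means without parameters. DPRM property: every totally listable subset of every $M^r$ is p.e. definable. A p.e. interpretation $\theta:\mathfrak{M}\dashrightarrow\mathfrak{N}$ of rank $r$ ($\mathfrak{N}$ a $\mathscr{K}$-structure with domain $N$) is a surjection $\theta:\mathrm{dom}(\theta)\to N$, $\mathrm{dom}(\theta)\subseteq M^r$ p.e. $\mathscr{L}$-definable, with $\theta^*(s^{\mathfrak{N}})$ p.e. $\mathscr{L}$-definable for all $s\in\mathscr{K}$. The composition $\theta_2\bullet\theta_1$ of $\theta_1:\mathfrak{M}_1\dashrightarrow\mathfrak{M}_2$ and $\theta_2:\mathfrak{M}_2\dashrightarrow\mathfrak{M}_3$ has domain $\theta_1^*(\mathrm{dom}(\theta_2))$ and is the map $\theta_2\circ\theta_1^{(\mathrm{rank}\,\theta_2)}$; its rank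 is the product of ranks. $\Gamma(\theta)=\{(x_0,\mathbf{x}):\mathbf{x}\in\mathrm{dom}(\theta),x_0=\theta(\mathbf{x})\}$. A pair $(\theta_1,\theta_2)$ of p.e. interpretations $\theta_1:\mathfrak{M}_1\dashrightarrow\mathfrak{M}_2$, $\theta_2:\mathfrak{M}_2\dashrightarrow\mathfrak{M}_1$ is a p.e. bi-interpretation if $\Gamma(\theta_1\bullet\theta_2)$ is p.e. definable over $\mathfrak{M}_2$ and $\Gamma(\theta_2\bullet\theta_1)$ is p.e. definable over $\mathfrak{M}_1$. -}

module Defs where

open import Data.Nat using (ℕ; zero; suc; _*_; _<_)
open import Data.Fin using (Fin; toℕ)
open import Data.Vec using (Vec; []; _∷_; map; lookup; concat)
open import Data.Vec.Relation.Unary.All using (All; []; _∷_)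
open import Data.Product using (Σ; ∃; _×_; _,_)
open import Relation.Binary.PropositionalEquality using (_≡_)
open import Function.Bundles using (_⇔_)

data PR : ℕ → Set where
  Z    : ∀ {n} → PR n
  S    : PR 1
  P    : ∀ {n} → Fin n → PR n
  comp : ∀ {m n} → PR m → Vec (PR n) m → PR n
  prim : ∀ {n} → PR n → PR (suc (suc n)) → PR (suc n)
  mu   : ∀ {n} → PR (suc n) → PR n

mutual
  data _[_]⇓_ : ∀ {n} → PR n → Vec ℕ n → ℕ → Set where
    Z⇓    : ∀ {n} {v : Vec ℕ n} → Z [ v ]⇓ 0
    S⇓    : ∀ {x} → S [ x ∷ [] ]⇓ suc x
    P⇓    : ∀ {n} {i : Fin n} {v} → P i [ v ]⇓ lookup v i
    comp⇓ : ∀ {m n} {f : PR m} {gs : Vec (PR n) m} {v ws y} →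
            gs [ v ]⇓* ws → f [ ws ]⇓ y → comp f gs [ v ]⇓ y
    prim0 : ∀ {n} {f : PR n} {g} {v y} →
            f [ v ]⇓ y → prim f g [ 0 ∷ v ]⇓ y
    primS : ∀ {n} {f : PR n} {g} {k v z y} →
            prim f g [ k ∷ v ]⇓ z → g [ k ∷ z ∷ v ]⇓ y →
            prim f g [ suc k ∷ v ]⇓ y
    mu⇓   : ∀ {n} {f : PR (suc n)} {v k} →
            f [ k ∷ v ]⇓ 0 →
            (∀ i → i < k → Σ ℕ λ m → f [ i ∷ v ]⇓ suc m) →
            mu f [ v ]⇓ k

  data _[_]⇓*_ : ∀ {m n} → Vec (PR n) m → Vec ℕ n → Vec ℕ m → Set where
    []  : ∀ {n} {v : Vec ℕ n} → [] [ v ]⇓* []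
    _∷_ : ∀ {m n} {g} {gs : Vec (PR n) m} {v y ys} →
          g [ v ]⇓ y → gs [ v ]⇓* ys → (g ∷ gs) [ v ]⇓* (y ∷ ys)

Listable : ∀ {k} → (Vec ℕ k → Set) → Set
Listable {k} A = Σ (PR k) λ e → ∀ v → A v ⇔ (Σ ℕ λ y → e [ v ]⇓ y)

TotalRecursive : (ℕ → ℕ) → Set
TotalRecursive φ = Σ (PR 1) λ e → ∀ n → e [ n ∷ [] ]⇓ φ n

-- Languages and structures (equality is always interpreted as _≡_)

record Language : Set₁ where
  field
    FSym  : Set
    farity : FSym → ℕ
    RSym  : Set
    rarity : RSym → ℕ

record Structure (L : Language) : Set₁ where
  open Language L
  field
    Carrier : Set
    fun : (f : FSym) → Vec Carrier (farity f) → Carrier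
    rel : (R : RSym) → Vec Carrier (rarity R) → Set

EqRel : {A : Set} → Vec A 2 → Set
EqRel (x ∷ y ∷ []) = x ≡ y

module _ {L : Language} where
  open Language L

  graph : (𝔐 : Structure L) (f : FSym) →
          Vec (Structure.Carrier 𝔐) (suc (farity f)) → Set
  graph 𝔐 f (x₀ ∷ xs) = x₀ ≡ Structure.fun 𝔐 f xs

  data Term (n : ℕ) : Set where
    var : Fin n → Term n
    app : (f : FSym) → Vec (Term n) (farity f) → Term n

  data PEFormula (n : ℕ) : Set where
    _≐_  : Term n → Term n → PEFormula n
    relA : (R : RSym) → Vec (Term n) (rarity R) → PEFormula n
    _∧_  : PEFormula n → PEFormula n → PEFormula n
    _∨_  : PEFormula n → PEFormula n → PEFormula n
    ex   : PEFormula (suc n) → PEFormula n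

  module _ (𝔐 : Structure L) where
    open Structure 𝔐

    mutual
      evalT : ∀ {n} → Term n → Vec Carrier n → Carrier
      evalT (var i) σ = lookup σ i
      evalT (app f ts) σ = fun f (evalTs ts σ)

      evalTs : ∀ {n k} → Vec (Term n) k → Vec Carrier n → Vec Carrier k
      evalTs [] σ = []
      evalTs (t ∷ ts) σ = evalT t σ ∷ evalTs ts σ

    open import Data.Sum using (_⊎_)

    Sat : ∀ {n} → PEFormula n → Vec Carrier n → Set
    Sat (s ≐ t) σ = evalT s σ ≡ evalT t σ
    Sat (relA R ts) σ = rel R (evalTs ts σ)
    Sat (φ ∧ ψ) σ = Sat φ σ × Sat ψ σ
    Sat (φ ∨ ψ) σ = Sat φ σ ⊎ Sat ψ σ
    Sat (ex φ) σ = Σ Carrier λ a → Sat φ (a ∷ σ)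

    -- p.e. definable (without parameters) subsets of M^r
    PEDefinable : ∀ {r} → (Vec Carrier r → Set) → Set
    PEDefinable {r} X = Σ (PEFormula r) λ φ → ∀ v → X v ⇔ Sat φ v

    pullℕ : ∀ {r} → (ℕ → Carrier) → (Vec Carrier r → Set) → Vec ℕ r → Set
    pullℕ ρ X v = X (map ρ v)

    record ListablePresentation : Set where
      field
        ρ      : ℕ → Carrier
        surj   : ∀ m → Σ ℕ λ n → ρ n ≡ m
        eqL    : Listable (pullℕ ρ EqRel)
        funL   : ∀ f → Listable (pullℕ ρ (graph 𝔐 f))
        relL   : ∀ R → Listable (pullℕ ρ (rel R))
    open ListablePresentation public

    TotallyListable : ∀ {r} → (Vec Carrier r → Set) → Set
    TotallyListable X = ∀ (π : ListablePresentation) → Listable (pullℕ (ρ π) X)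

    EquivPres : ListablePresentation → ListablePresentation → Set
    EquivPres π γ = Σ (ℕ → ℕ) λ φ → TotalRecursive φ × (∀ n → ρ γ n ≡ ρ π (φ n))

    UniquelyListable : Set
    UniquelyListable = ListablePresentation ×
                       (∀ π γ → EquivPres π γ)

    DPRM : Set₁
    DPRM = ∀ r (X : Vec Carrier r → Set) → TotallyListable X → PEDefinable X

module _ {L K : Language} (𝔐 : Structure L) (𝔑 : Structure K) where
  private
    M = Structure.Carrier 𝔐
    N = Structure.Carrier 𝔑

  applyAll : ∀ {r k} {D : Vec M r → Set} (θ : (v : Vec M r) → D v → N)
             (xss : Vec (Vec M r) k) → All D xss → Vec N k
  applyAll θ [] [] = []
  applyAll θ (xs ∷ xss) (d ∷ ds) = θ xs d ∷ applyAll θ xss ds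

  -- θ*(S) ⊆ M^(k·r) for S ⊆ N^k, with M^(k·r) identified with (M^r)^k
  -- via concatenation
  pullθ : ∀ {r k} {D : Vec M r → Set} (θ : (v : Vec M r) → D v → N) →
          (Vec N k → Set) → Vec M (k * r) → Set
  pullθ {r} {k} {D} θ T w =
    Σ (Vec (Vec M r) k) λ xss → concat xss ≡ w ×
      Σ (All D xss) λ ds → T (applyAll θ xss ds)

  record PEInterpretation : Set₁ where
    field
      rank   : ℕ
      dom    : Vec M rank → Set
      domDef : PEDefinable 𝔐 dom
      θ      : (v : Vec M rank) → dom v → N
      θ-irr  : ∀ v (d d′ : dom v) → θ v d ≡ θ v d′
      surj   : ∀ y → Σ (Vec M rank) λ v → Σ (dom v) λ d → θ v d ≡ y
      eqDef  : PEDefinable 𝔐 (pullθ θ EqRel)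
      funDef : ∀ f → PEDefinable 𝔐 (pullθ θ (graph 𝔑 f))
      relDef : ∀ R → PEDefinable 𝔐 (pullθ θ (Structure.rel 𝔑 R))

open PEInterpretation public

-- Γ(θ₂ • θ₁) ⊆ M₁^(1 + rank θ₂ · rank θ₁) for θ₁ : 𝔐₁ ⇢ 𝔐₂, θ₂ : 𝔐₂ ⇢ 𝔐₁:
-- (x₀ , x) with x ∈ dom(θ₂ • θ₁) = θ₁*(dom θ₂) and x₀ = θ₂(θ₁^(rank θ₂)(x)).
GammaComp : ∀ {L₁ L₂} {𝔐₁ : Structure L₁} {𝔐₂ : Structure L₂}
            (θ₁ : PEInterpretation 𝔐₁ 𝔐₂) (θ₂ : PEInterpretation 𝔐₂ 𝔐₁) →
            Vec (Structure.Carrier 𝔐₁) (suc (rank θ₂ * rank θ₁)) → Set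
GammaComp {𝔐₁ = 𝔐₁} {𝔐₂} θ₁ θ₂ (x₀ ∷ w) =
  pullθ 𝔐₁ 𝔐₂ (θ θ₁)
    (λ ys → Σ (dom θ₂ ys) λ d → x₀ ≡ θ θ₂ ys d) w

PEBiInterpretation : ∀ {L₁ L₂} {𝔐₁ : Structure L₁} {𝔐₂ : Structure L₂}
  (θ₁ : PEInterpretation 𝔐₁ 𝔐₂) (θ₂ : PEInterpretation 𝔐₂ 𝔐₁) → Set
PEBiInterpretation {𝔐₁ = 𝔐₁} {𝔐₂} θ₁ θ₂ =
  PEDefinable 𝔐₂ (GammaComp θ₂ θ₁) × PEDefinable 𝔐₁ (GammaComp θ₁ θ₂)

-- Listable sets are exactly the sets semidecided by a total recursive stage function that is
-- monotone in the stage (run a clocked evaluator of the μ-recursive program); such sets are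
-- closed under ∧, ∨ and ∃, so every p.e. definable set is listable under every listable
-- presentation. An interpretation α : 𝔄 ⇢ 𝔅 turns a listable presentation of 𝔄 into one of 𝔅,
-- by enumerating the codes of tuples in dom α.
--
-- (i) ⇒ (ii) is trivial. Γ(β • α) is totally listable for all interpretations α : 𝔄 ⇢ 𝔅 and
-- β : 𝔅 ⇢ 𝔄 of a uniquely listable 𝔄: for a presentation π of 𝔄, the presentation induced
-- through α and then β is π composed with a total recursive φ. This gives (iii) ⇒ (ii), and
-- with the DPRM property of 𝔐₂ the remaining half of (i). For (ii) ⇒ (iii), a totally listable
-- X ⊆ M₁ʳ pulls back to a totally listable θ₂*(X), which is p.e. definable over 𝔐₂; p.e.
-- formulas transfer along θ₁, and X(x) holds iff some u ∈ θ₁*(θ₂*(X)) has, for each i, its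
-- i-th block related to xᵢ by Γ(θ₂ • θ₁).

module Submission where

open import Defs
open import Data.Nat using (ℕ; zero; suc; _+_; _*_; _∸_; _<_; _≤_; z≤n; s≤s; pred; _⊔_; s≤s⁻¹)
open import Data.Nat.Properties
open import Data.Nat.Tactic.RingSolver
open import Data.Fin using (Fin; zero; suc; lift)
open import Data.Vec using (Vec; []; _∷_; lookup; head; tail; map; tabulate; _++_; concat; allFin; take; drop)
open import Data.Vec.Properties using (take-map; drop-map; take++drop≡id; tabulate∘lookup; tabulate-∘; lookup-map; ∷-injective; ∷-injectiveˡ; ∷-injectiveʳ; map-concat; ++-injectiveˡ; ++-injectiveʳ; map-++; lookup∘tabulate; tabulate-cong; map-lookup-allFin)
open import Data.Vec.Relation.Unary.All using (All; []; _∷_)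
open import Data.Product using (Σ; _×_; _,_; proj₁; proj₂)
open import Data.Sum using (_⊎_; inj₁; inj₂; [_,_]′)
open import Data.Empty using (⊥-elim)
open import Data.Unit using (⊤; tt)
open import Relation.Binary.PropositionalEquality
open import Relation.Binary.Definitions using (tri<; tri≈; tri>)
open import Relation.Nullary using (¬_; Dec; yes; no)
open import Function.Bundles using (_⇔_; mk⇔; Equivalence)
open Equivalence

-- Partial recursive functions

mutual
  ⇓-deterministic : ∀ {n} {e : PR n} {v y y′} → e [ v ]⇓ y → e [ v ]⇓ y′ → y ≡ y′
  ⇓-deterministic Z⇓ Z⇓ = refl
  ⇓-deterministic S⇓ S⇓ = refl
  ⇓-deterministic P⇓ P⇓ = refl
  ⇓-deterministic (comp⇓ gs⇓ f⇓) (comp⇓ gs⇓′ f⇓′) with ⇓*-deterministic gs⇓ gs⇓′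
  ... | refl = ⇓-deterministic f⇓ f⇓′
  ⇓-deterministic (prim0 f⇓) (prim0 f⇓′) = ⇓-deterministic f⇓ f⇓′
  ⇓-deterministic (primS r⇓ g⇓) (primS r⇓′ g⇓′) with ⇓-deterministic r⇓ r⇓′
  ... | refl = ⇓-deterministic g⇓ g⇓′
  ⇓-deterministic (mu⇓ {k = k} f⇓ below) (mu⇓ {k = k′} f⇓′ below′) with <-cmp k k′
  ... | tri< k<k′ _ _ = ⊥-elim (0≢1+n (⇓-deterministic f⇓ (proj₂ (below′ k k<k′))))
  ... | tri≈ _ k≡k′ _ = k≡k′
  ... | tri> _ _ k>k′ = ⊥-elim (0≢1+n (⇓-deterministic f⇓′ (proj₂ (below k′ k>k′))))

  ⇓*-deterministic : ∀ {m n} {es : Vec (PR n) m} {v ys ys′} → es [ v ]⇓* ys → es [ v ]⇓* ys′ → ys ≡ ys′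
  ⇓*-deterministic [] [] = refl
  ⇓*-deterministic (e⇓ ∷ es⇓) (e⇓′ ∷ es⇓′) = cong₂ _∷_ (⇓-deterministic e⇓ e⇓′) (⇓*-deterministic es⇓ es⇓′)

lookup-⇓* : ∀ {m n} {es : Vec (PR n) m} {v ys} → es [ v ]⇓* ys → (i : Fin m) → lookup es i [ v ]⇓ lookup ys i
lookup-⇓* (e⇓ ∷ es⇓) zero = e⇓
lookup-⇓* (e⇓ ∷ es⇓) (suc i) = lookup-⇓* es⇓ i

Recursive : ∀ {n} → (Vec ℕ n → ℕ) → Set
Recursive {n} f = Σ (PR n) λ e → ∀ v → e [ v ]⇓ f v

RecursiveVec : ∀ {n m} → (Vec ℕ n → Vec ℕ m) → Set
RecursiveVec {n} {m} g = Σ (Vec (PR n) m) λ es → ∀ v → es [ v ]⇓* g v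

unary : (ℕ → ℕ) → Vec ℕ 1 → ℕ
unary op (x ∷ []) = op x

binary : (ℕ → ℕ → ℕ) → Vec ℕ 2 → ℕ
binary op (x ∷ y ∷ []) = op x y

rec-suc : Recursive (unary suc)
rec-suc = S , λ { (x ∷ []) → S⇓ }

module _ {n : ℕ} where
  rec-cong : {f g : Vec ℕ n → ℕ} → (∀ v → f v ≡ g v) → Recursive f → Recursive g
  rec-cong f≡g (e , e⇓) = e , λ v → subst (e [ v ]⇓_) (f≡g v) (e⇓ v)

  recV-cong : ∀ {m} {f g : Vec ℕ n → Vec ℕ m} → (∀ v → f v ≡ g v) → RecursiveVec f → RecursiveVec g
  recV-cong f≡g (es , es⇓) = es , λ v → subst (_ [ v ]⇓*_) (f≡g v) (es⇓ v)

  recV-[] : RecursiveVec {n} {0} (λ _ → [])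
  recV-[] = [] , λ v → []

  recV-∷ : ∀ {m} {f : Vec ℕ n → ℕ} {g : Vec ℕ n → Vec ℕ m} → Recursive f → RecursiveVec g → RecursiveVec (λ v → f v ∷ g v)
  recV-∷ (e , e⇓) (es , es⇓) = (e ∷ es) , λ v → e⇓ v ∷ es⇓ v

  recV-lookup : ∀ {m} {g : Vec ℕ n → Vec ℕ m} → RecursiveVec g → (i : Fin m) → Recursive (λ v → lookup (g v) i)
  recV-lookup (es , es⇓) i = lookup es i , λ v → lookup-⇓* (es⇓ v) i

  rec-∘ : ∀ {m} {f : Vec ℕ m → ℕ} {g : Vec ℕ n → Vec ℕ m} → Recursive f → RecursiveVec g → Recursive (λ v → f (g v))
  rec-∘ (e , e⇓) (es , es⇓) = comp e es , λ v → comp⇓ (es⇓ v) (e⇓ _)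

  rec-proj : (i : Fin n) → Recursive (λ v → lookup v i)
  rec-proj i = P i , λ v → P⇓

  rec-const : ∀ c → Recursive {n} (λ _ → c)
  rec-const zero = Z , λ v → Z⇓
  rec-const (suc c) = rec-∘ rec-suc (recV-∷ (rec-const c) recV-[])

  recV-tabulate : ∀ {m} (g : Vec ℕ n → Fin m → ℕ) → ((i : Fin m) → Recursive (λ v → g v i)) → RecursiveVec (λ v → tabulate (g v))
  recV-tabulate {zero} g rec-g = recV-[]
  recV-tabulate {suc m} g rec-g = recV-∷ (rec-g zero) (recV-tabulate (λ v i → g v (suc i)) (λ i → rec-g (suc i)))

×⇔∷≡∷ : ∀ {A : Set} {n} {x y : A} {xs ys : Vec A n} → (x ≡ y × xs ≡ ys) ⇔ (x ∷ xs ≡ y ∷ ys)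
×⇔∷≡∷ = mk⇔ (λ { (refl , refl) → refl }) ∷-injective

recV-∘ : ∀ {n m k} {g : Vec ℕ m → Vec ℕ k} {h : Vec ℕ n → Vec ℕ m} → RecursiveVec g → RecursiveVec h → RecursiveVec (λ v → g (h v))
recV-∘ {g = g} {h} rec-g rec-h =
  recV-cong (λ v → tabulate∘lookup (g (h v))) (recV-tabulate _ (λ i → rec-∘ (recV-lookup rec-g i) rec-h))

recV-id : ∀ {n} → RecursiveVec (λ (v : Vec ℕ n) → v)
recV-id = recV-cong tabulate∘lookup (recV-tabulate lookup rec-proj)

rec-head : ∀ {n} → Recursive (λ (v : Vec ℕ (suc n)) → head v)
rec-head = rec-cong (λ { (x ∷ v) → refl }) (rec-proj zero)

recV-tail : ∀ {n} → RecursiveVec (λ (v : Vec ℕ (suc n)) → tail v)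
recV-tail = recV-cong (λ { (x ∷ v) → tabulate∘lookup v }) (recV-tabulate _ (λ i → rec-proj (suc i)))

recV-tail³ : ∀ {n} → RecursiveVec (λ (w : Vec ℕ (3 + n)) → tail (tail (tail w)))
recV-tail³ = recV-∘ recV-tail (recV-∘ recV-tail recV-tail)

primRec : ∀ {n} → (Vec ℕ n → ℕ) → (Vec ℕ (suc (suc n)) → ℕ) → Vec ℕ (suc n) → ℕ
primRec f g (zero ∷ v) = f v
primRec f g (suc k ∷ v) = g (k ∷ primRec f g (k ∷ v) ∷ v)

rec-primRec : ∀ {n} {f : Vec ℕ n → ℕ} {g} → Recursive f → Recursive g → Recursive (primRec f g)
rec-primRec {f = f} {g} (e , e⇓) (e′ , e′⇓) = prim e e′ , prim⇓
  where
  prim⇓ : ∀ v → prim e e′ [ v ]⇓ primRec f g v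
  prim⇓ (zero ∷ v) = prim0 (e⇓ v)
  prim⇓ (suc k ∷ v) = primS (prim⇓ (k ∷ v)) (e′⇓ _)

module _ {n : ℕ} where
  rec-app₁ : ∀ {op} {f : Vec ℕ n → ℕ} → Recursive (unary op) → Recursive f → Recursive (λ v → op (f v))
  rec-app₁ rec-op rec-f = rec-∘ rec-op (recV-∷ rec-f recV-[])

  rec-app₂ : ∀ {op} {f g : Vec ℕ n → ℕ} → Recursive (binary op) → Recursive f → Recursive g → Recursive (λ v → op (f v) (g v))
  rec-app₂ rec-op rec-f rec-g = rec-∘ rec-op (recV-∷ rec-f (recV-∷ rec-g recV-[]))

tabulate∘lookup-map : ∀ {m} {A B : Set} (f : A → B) (xs : Vec A m) → tabulate (λ i → f (lookup xs i)) ≡ map f xs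
tabulate∘lookup-map f xs = trans (tabulate-∘ f (lookup xs)) (cong (map f) (tabulate∘lookup xs))

recV-map : ∀ {n m op} {g : Vec ℕ n → Vec ℕ m} → Recursive (unary op) → RecursiveVec g → RecursiveVec (λ v → map op (g v))
recV-map {op = op} {g} rec-op rec-g =
  recV-cong (λ v → tabulate∘lookup-map op (g v)) (recV-tabulate _ (λ i → rec-app₁ rec-op (recV-lookup rec-g i)))

rec-+ : Recursive (binary _+_)
rec-+ = rec-cong +-by-primRec (rec-primRec (rec-proj zero) (rec-app₁ rec-suc (rec-proj (suc zero))))
  where
  +-by-primRec : ∀ v → primRec (λ v → lookup v zero) (λ w → suc (lookup w (suc zero))) v ≡ binary _+_ v
  +-by-primRec (zero ∷ y ∷ []) = refl
  +-by-primRec (suc x ∷ y ∷ []) = cong suc (+-by-primRec (x ∷ y ∷ []))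

rec-* : Recursive (binary _*_)
rec-* = rec-cong *-by-primRec (rec-primRec (rec-const 0) (rec-app₂ rec-+ (rec-proj (suc zero)) (rec-proj (suc (suc zero)))))
  where
  *-by-primRec : ∀ v → primRec (λ _ → 0) (λ w → lookup w (suc zero) + lookup w (suc (suc zero))) v ≡ binary _*_ v
  *-by-primRec (zero ∷ y ∷ []) = refl
  *-by-primRec (suc x ∷ y ∷ []) = trans (cong (_+ y) (*-by-primRec (x ∷ y ∷ []))) (+-comm (x * y) y)

rec-pred : Recursive (unary pred)
rec-pred = rec-cong (λ { (zero ∷ []) → refl ; (suc x ∷ []) → refl }) (rec-primRec (rec-const 0) (rec-proj zero))

rec-∸ : Recursive (binary _∸_)
rec-∸ = rec-cong (λ { (x ∷ y ∷ []) → ∸-by-primRec x y })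
  (rec-∘ (rec-primRec (rec-proj zero) (rec-app₁ rec-pred (rec-proj (suc zero))))
         (recV-∷ (rec-proj (suc zero)) (recV-∷ (rec-proj zero) recV-[])))
  where
  ∸-by-primRec : ∀ x y → primRec (λ v → lookup v zero) (λ w → pred (lookup w (suc zero))) (y ∷ x ∷ []) ≡ x ∸ y
  ∸-by-primRec x zero = refl
  ∸-by-primRec x (suc y) = trans (cong pred (∸-by-primRec x y)) (pred[m∸n]≡m∸[1+n] x y)

sg : ℕ → ℕ
sg zero = 0
sg (suc _) = 1

sgᶜ : ℕ → ℕ
sgᶜ zero = 1
sgᶜ (suc _) = 0

rec-sg : Recursive (unary sg)
rec-sg = rec-cong (λ { (zero ∷ []) → refl ; (suc x ∷ []) → refl }) (rec-primRec (rec-const 0) (rec-const 1))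

rec-sgᶜ : Recursive (unary sgᶜ)
rec-sgᶜ = rec-cong (λ { (zero ∷ []) → refl ; (suc x ∷ []) → refl }) (rec-primRec (rec-const 1) (rec-const 0))

product : ∀ {m} → Vec ℕ m → ℕ
product [] = 1
product (x ∷ xs) = x * product xs

rec-product : ∀ {m} → Recursive (product {m})
rec-product {zero} = rec-cong (λ { [] → refl }) (rec-const 1)
rec-product {suc m} = rec-cong (λ { (x ∷ v) → refl }) (rec-app₂ rec-* (rec-proj zero) (rec-∘ rec-product recV-tail))

take-++ : ∀ {j k} {A : Set} (u : Vec A j) (v : Vec A k) → take j (u ++ v) ≡ u
take-++ [] v = refl
take-++ (x ∷ u) v = cong (x ∷_) (take-++ u v)

drop-++ : ∀ {j k} {A : Set} (u : Vec A j) (v : Vec A k) → drop j (u ++ v) ≡ v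
drop-++ [] v = refl
drop-++ (x ∷ u) v = drop-++ u v

recV-take : ∀ j {k} → RecursiveVec (λ (w : Vec ℕ (j + k)) → take j w)
recV-take zero = recV-[]
recV-take (suc j) = recV-cong (λ { (x ∷ w) → refl }) (recV-∷ rec-head (recV-∘ (recV-take j) recV-tail))

recV-drop : ∀ j {k} → RecursiveVec (λ (w : Vec ℕ (j + k)) → drop j w)
recV-drop zero = recV-id
recV-drop (suc j) = recV-cong (λ { (x ∷ w) → refl }) (recV-∘ (recV-drop j) recV-tail)

recV-++ : ∀ {n j k} {a : Vec ℕ n → Vec ℕ j} {b : Vec ℕ n → Vec ℕ k} → RecursiveVec a → RecursiveVec b → RecursiveVec (λ w → a w ++ b w)
recV-++ {j = zero} {a = a} {b} rec-a rec-b = recV-cong (λ w → cong (_++ b w) (sym (empty (a w)))) rec-b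
  where
  empty : (x : Vec ℕ 0) → x ≡ []
  empty [] = refl
recV-++ {j = suc j} {a = a} {b} rec-a rec-b =
  recV-cong (λ w → head∷tail++ (a w) (b w)) (recV-∷ (recV-lookup rec-a zero) (recV-++ {a = λ w → tail (a w)} (recV-∘ recV-tail rec-a) rec-b))
  where
  head∷tail++ : ∀ {j k} (x : Vec ℕ (suc j)) (y : Vec ℕ k) → lookup x zero ∷ (tail x ++ y) ≡ x ++ y
  head∷tail++ (x ∷ xs) y = refl

-- Clocked evaluation

-- search c n runs the μ-search over the clock values c 0, c 1, … for n steps:
-- 0 = still searching, 1 = stuck on a call that has not halted yet,
-- suc (suc i) = found the least i whose call halted with output 0.
searchStep : ℕ → ℕ → ℕ → ℕ
searchStep zero zero n = 1
searchStep zero (suc zero) n = suc (suc n)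
searchStep zero (suc (suc _)) n = 0
searchStep (suc s) c n = suc s

search : (ℕ → ℕ) → ℕ → ℕ
search c zero = 0
search c (suc n) = searchStep (search c n) (c n) n

-- clock e t v ≡ suc y means that e halts on v with output y within budget t;
-- the value 0 means "no result yet".
mutual
  clock : ∀ {n} → PR n → ℕ → Vec ℕ n → ℕ
  clock Z t v = 1
  clock S t (x ∷ []) = suc (suc x)
  clock (P i) t v = suc (lookup v i)
  clock (comp f gs) t v = sg (product (clocks gs t v)) * clock f t (map pred (clocks gs t v))
  clock (prim f g) t (k ∷ v) = primClock f g t k v
  clock (mu f) t v = pred (search (λ j → clock f t (j ∷ v)) t)

  clocks : ∀ {m n} → Vec (PR n) m → ℕ → Vec ℕ n → Vec ℕ m
  clocks [] t v = []
  clocks (g ∷ gs) t v = clock g t v ∷ clocks gs t v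

  primClock : ∀ {n} → PR n → PR (suc (suc n)) → ℕ → ℕ → Vec ℕ n → ℕ
  primClock f g t zero v = clock f t v
  primClock f g t (suc k) v = sg (primClock f g t k v) * clock g t (k ∷ pred (primClock f g t k v) ∷ v)

Clock : ∀ {n} → PR n → Vec ℕ (suc n) → ℕ
Clock e (t ∷ v) = clock e t v

Clocks : ∀ {m n} → Vec (PR n) m → Vec ℕ (suc n) → Vec ℕ m
Clocks gs (t ∷ v) = clocks gs t v

searchStep-arithmetic : ∀ s c n → s + sgᶜ s * (sgᶜ c + sgᶜ (pred c) * sg c * (n + 2)) ≡ searchStep s c n
searchStep-arithmetic zero zero n = refl
searchStep-arithmetic zero (suc zero) n = normalise n
  where
  normalise : ∀ n → 0 + 1 * (0 + 1 * 1 * (n + 2)) ≡ suc (suc n)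
  normalise = solve-∀
searchStep-arithmetic zero (suc (suc c)) n = refl
searchStep-arithmetic (suc s) c n = +-identityʳ (suc s)

rec-searchStep : Recursive (λ (w : Vec ℕ 3) → searchStep (lookup w zero) (lookup w (suc zero)) (lookup w (suc (suc zero))))
rec-searchStep = rec-cong (λ w → searchStep-arithmetic _ _ _)
  (rec-app₂ rec-+ s (rec-app₂ rec-* (rec-app₁ rec-sgᶜ s)
    (rec-app₂ rec-+ (rec-app₁ rec-sgᶜ c)
      (rec-app₂ rec-* (rec-app₂ rec-* (rec-app₁ rec-sgᶜ (rec-app₁ rec-pred c)) (rec-app₁ rec-sg c)) (rec-app₂ rec-+ n (rec-const 2))))))
  where
  s = rec-proj zero
  c = rec-proj (suc zero)
  n = rec-proj (suc (suc zero))

mutual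
  rec-Clock : ∀ {n} (e : PR n) → Recursive (Clock e)
  rec-Clock Z = rec-cong (λ { (t ∷ v) → refl }) (rec-const 1)
  rec-Clock S = rec-cong (λ { (t ∷ x ∷ []) → refl }) (rec-app₁ rec-suc (rec-app₁ rec-suc (rec-proj (suc zero))))
  rec-Clock (P i) = rec-cong (λ { (t ∷ v) → refl }) (rec-app₁ rec-suc (rec-proj (suc i)))
  rec-Clock (comp f gs) = rec-cong (λ { (t ∷ v) → refl })
    (rec-app₂ rec-* (rec-app₁ rec-sg (rec-∘ rec-product (recV-Clocks gs)))
                    (rec-∘ (rec-Clock f) (recV-∷ (rec-proj zero) (recV-map rec-pred (recV-Clocks gs)))))
  rec-Clock {suc n} (prim f g) = rec-cong (λ { (t ∷ k ∷ v) → primClock-by-primRec t k v })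
    (rec-∘ (rec-primRec (rec-Clock f) rec-step) (recV-∷ (rec-proj (suc zero)) (recV-∷ (rec-proj zero) (recV-∘ recV-tail recV-tail))))
    where
    step : Vec ℕ (3 + n) → ℕ
    step w = sg (lookup w (suc zero))
           * Clock g (lookup w (suc (suc zero)) ∷ lookup w zero ∷ pred (lookup w (suc zero)) ∷ tail (tail (tail w)))
    rec-step : Recursive step
    rec-step = rec-app₂ rec-* (rec-app₁ rec-sg (rec-proj (suc zero)))
      (rec-∘ (rec-Clock g) (recV-∷ (rec-proj (suc (suc zero)))
                           (recV-∷ (rec-proj zero) (recV-∷ (rec-app₁ rec-pred (rec-proj (suc zero))) recV-tail³))))
    primClock-by-primRec : ∀ t k v → primRec (Clock f) step (k ∷ t ∷ v) ≡ primClock f g t k v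
    primClock-by-primRec t zero v = refl
    primClock-by-primRec t (suc k) v rewrite primClock-by-primRec t k v = refl
  rec-Clock {n} (mu f) = rec-cong (λ { (t ∷ v) → cong pred (search-by-primRec t t v) })
    (rec-app₁ rec-pred (rec-∘ (rec-primRec (rec-const 0) rec-step) (recV-∷ (rec-proj zero) recV-id)))
    where
    step : Vec ℕ (3 + n) → ℕ
    step w = searchStep (lookup w (suc zero)) (Clock f (lookup w (suc (suc zero)) ∷ lookup w zero ∷ tail (tail (tail w)))) (lookup w zero)
    rec-step : Recursive step
    rec-step = rec-∘ rec-searchStep
      (recV-∷ (rec-proj (suc zero))
      (recV-∷ (rec-∘ (rec-Clock f) (recV-∷ (rec-proj (suc (suc zero))) (recV-∷ (rec-proj zero) recV-tail³)))
      (recV-∷ (rec-proj zero) recV-[])))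
    search-by-primRec : ∀ t n v → primRec (λ _ → 0) step (n ∷ t ∷ v) ≡ search (λ j → clock f t (j ∷ v)) n
    search-by-primRec t zero v = refl
    search-by-primRec t (suc n) v rewrite search-by-primRec t n v = refl

  recV-Clocks : ∀ {m n} (gs : Vec (PR n) m) → RecursiveVec (Clocks gs)
  recV-Clocks [] = recV-cong (λ { (t ∷ v) → refl }) recV-[]
  recV-Clocks (g ∷ gs) = recV-cong (λ { (t ∷ v) → refl }) (recV-∷ (rec-Clock g) (recV-Clocks gs))

map-pred-suc : ∀ {m} (ws : Vec ℕ m) → map pred (map suc ws) ≡ ws
map-pred-suc [] = refl
map-pred-suc (x ∷ ws) = cong (x ∷_) (map-pred-suc ws)

product≡suc⇒map-suc : ∀ {m} (W : Vec ℕ m) {p} → product W ≡ suc p → Σ (Vec ℕ m) λ ws → W ≡ map suc ws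
product≡suc⇒map-suc [] eq = [] , refl
product≡suc⇒map-suc (suc x ∷ W) eq with product W in e
... | zero = ⊥-elim (0≢1+n (trans (sym (*-zeroʳ x)) eq))
... | suc q with product≡suc⇒map-suc W e
... | ws , refl = (x ∷ ws) , refl

product-map-suc : ∀ {m} (ws : Vec ℕ m) → Σ ℕ λ p → product (map suc ws) ≡ suc p
product-map-suc [] = 0 , refl
product-map-suc (x ∷ ws) with product-map-suc ws
... | p , e rewrite e = (p + x * suc p) , refl

sg*≡suc⁻¹ : ∀ a b {y} → sg a * b ≡ suc y → Σ ℕ (λ a′ → a ≡ suc a′) × (b ≡ suc y)
sg*≡suc⁻¹ (suc a) b eq = (a , refl) , trans (sym (+-identityʳ b)) eq

sg*≡suc : ∀ {a b y a′} → a ≡ suc a′ → b ≡ suc y → sg a * b ≡ suc y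
sg*≡suc refl refl = cong suc (+-identityʳ _)

guardedComp⁻¹ : ∀ {m} (C : Vec ℕ m → ℕ) (W : Vec ℕ m) {y} → sg (product W) * C (map pred W) ≡ suc y →
                Σ (Vec ℕ m) λ ws → W ≡ map suc ws × C ws ≡ suc y
guardedComp⁻¹ C W eq with sg*≡suc⁻¹ (product W) _ eq
... | (p , e) , e′ with product≡suc⇒map-suc W e
... | ws , refl = ws , refl , trans (cong C (sym (map-pred-suc ws))) e′

guardedComp : ∀ {m} (C : Vec ℕ m → ℕ) (W : Vec ℕ m) {y ws} → W ≡ map suc ws → C ws ≡ suc y →
              sg (product W) * C (map pred W) ≡ suc y
guardedComp C W {ws = ws} refl e = sg*≡suc (proj₂ (product-map-suc ws)) (trans (cong C (map-pred-suc ws)) e)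

guardedPred⁻¹ : ∀ (C : ℕ → ℕ) a {y} → sg a * C (pred a) ≡ suc y → Σ ℕ λ z → a ≡ suc z × C z ≡ suc y
guardedPred⁻¹ C a eq with sg*≡suc⁻¹ a _ eq
... | (z , refl) , e = z , refl , e

guardedPred : ∀ (C : ℕ → ℕ) a {y z} → a ≡ suc z → C z ≡ suc y → sg a * C (pred a) ≡ suc y
guardedPred C a {z = z} refl e = sg*≡suc {a′ = z} refl e

AtLeast2 : ℕ → Set
AtLeast2 x = Σ ℕ λ m → x ≡ suc (suc m)

search-running⁻¹ : ∀ c n → search c n ≡ 0 → ∀ j → j < n → AtLeast2 (c j)
search-running⁻¹ c (suc n) eq j j<n with search c n in e₁ | c n in e₂
search-running⁻¹ c (suc n) eq j j<n | zero | suc (suc m) with m≤n⇒m<n∨m≡n (s≤s⁻¹ j<n)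
... | inj₁ j<n′ = search-running⁻¹ c n e₁ j j<n′
... | inj₂ refl = m , e₂

search-found⁻¹ : ∀ c n {i} → search c n ≡ suc (suc i) → i < n × c i ≡ 1 × (∀ j → j < i → AtLeast2 (c j))
search-found⁻¹ c (suc n) eq with search c n in e₁ | c n in e₂
search-found⁻¹ c (suc n) refl | zero | suc zero = ≤-refl , e₂ , search-running⁻¹ c n e₁
search-found⁻¹ c (suc n) refl | suc s | _ with search-found⁻¹ c n e₁
... | i<n , ci≡1 , below = m<n⇒m<1+n i<n , ci≡1 , below

search-running : ∀ c {i} → (∀ j → j < i → AtLeast2 (c j)) → ∀ n → n ≤ i → search c n ≡ 0
search-running c below zero _ = refl
search-running c below (suc n) n<i with search c n | search-running c below n (<⇒≤ n<i) | below n n<i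
... | .0 | refl | m , e rewrite e = refl

search-found : ∀ c {i} → (∀ j → j < i → AtLeast2 (c j)) → c i ≡ 1 → ∀ n → i < n → search c n ≡ suc (suc i)
search-found c {i} below ci≡1 (suc n) i<1+n with m≤n⇒m<n∨m≡n (s≤s⁻¹ i<1+n)
... | inj₂ refl rewrite search-running c below i ≤-refl | ci≡1 = refl
... | inj₁ i<n rewrite search-found c below ci≡1 n i<n = refl

pred≡suc⁻¹ : ∀ x {y} → pred x ≡ suc y → x ≡ suc (suc y)
pred≡suc⁻¹ (suc x) refl = refl

commonBound : (Q : ℕ → ℕ → Set) → (∀ j {t t′} → t ≤ t′ → Q j t → Q j t′) →
              ∀ k → (∀ j → j < k → Σ ℕ (Q j)) → Σ ℕ λ T → ∀ j → j < k → Q j T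
commonBound Q Q-mono zero h = 0 , λ j ()
commonBound Q Q-mono (suc k) h with commonBound Q Q-mono k (λ j j<k → h j (m<n⇒m<1+n j<k)) | h k ≤-refl
... | T , QT | t , Qt = T ⊔ t , below
  where
  below : ∀ j → j < suc k → Q j (T ⊔ t)
  below j j<1+k with m≤n⇒m<n∨m≡n (s≤s⁻¹ j<1+k)
  ... | inj₁ j<k = Q-mono j (m≤m⊔n T t) (QT j j<k)
  ... | inj₂ refl = Q-mono j (m≤n⊔m T t) Qt

mutual
  clock-mono : ∀ {n} (e : PR n) {t t′ v y} → t ≤ t′ → clock e t v ≡ suc y → clock e t′ v ≡ suc y
  clock-mono Z t≤t′ eq = eq
  clock-mono S {v = x ∷ []} t≤t′ eq = eq
  clock-mono (P i) t≤t′ eq = eq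
  clock-mono (comp f gs) {t} {t′} {v} t≤t′ eq with guardedComp⁻¹ (clock f t) (clocks gs t v) eq
  ... | ws , eW , eC = guardedComp (clock f t′) (clocks gs t′ v) (clocks-mono gs t≤t′ eW) (clock-mono f t≤t′ eC)
  clock-mono (prim f g) {v = k ∷ v} t≤t′ eq = primClock-mono f g k t≤t′ eq
  clock-mono (mu f) {t} {t′} {v} t≤t′ eq with search-found⁻¹ _ t (pred≡suc⁻¹ _ eq)
  ... | i<t , fi , below = cong pred (search-found _ (λ j j<i → proj₁ (below j j<i) , clock-mono f t≤t′ (proj₂ (below j j<i)))
                                                    (clock-mono f t≤t′ fi) t′ (≤-trans i<t t≤t′))

  clocks-mono : ∀ {m n} (gs : Vec (PR n) m) {t t′ v ws} → t ≤ t′ → clocks gs t v ≡ map suc ws → clocks gs t′ v ≡ map suc ws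
  clocks-mono [] {ws = []} t≤t′ eq = refl
  clocks-mono (g ∷ gs) {ws = w ∷ ws} t≤t′ eq = cong₂ _∷_ (clock-mono g t≤t′ (cong head eq)) (clocks-mono gs t≤t′ (cong tail eq))

  primClock-mono : ∀ {n} (f : PR n) g k {t t′ v y} → t ≤ t′ → primClock f g t k v ≡ suc y → primClock f g t′ k v ≡ suc y
  primClock-mono f g zero t≤t′ eq = clock-mono f t≤t′ eq
  primClock-mono f g (suc k) {t} {t′} {v} t≤t′ eq with guardedPred⁻¹ (λ z → clock g t (k ∷ z ∷ v)) (primClock f g t k v) eq
  ... | z , e₁ , e₂ = guardedPred (λ z → clock g t′ (k ∷ z ∷ v)) (primClock f g t′ k v) (primClock-mono f g k t≤t′ e₁) (clock-mono g t≤t′ e₂)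

mutual
  clock-sound : ∀ {n} (e : PR n) {t v y} → clock e t v ≡ suc y → e [ v ]⇓ y
  clock-sound Z refl = Z⇓
  clock-sound S {v = x ∷ []} refl = S⇓
  clock-sound (P i) refl = P⇓
  clock-sound (comp f gs) {t} {v} eq with guardedComp⁻¹ (clock f t) (clocks gs t v) eq
  ... | ws , eW , eC = comp⇓ (clocks-sound gs eW) (clock-sound f eC)
  clock-sound (prim f g) {v = k ∷ v} eq = primClock-sound f g k eq
  clock-sound (mu f) {t} {v} eq with search-found⁻¹ _ t (pred≡suc⁻¹ _ eq)
  ... | _ , fi , below = mu⇓ (clock-sound f fi) (λ j j<i → proj₁ (below j j<i) , clock-sound f (proj₂ (below j j<i)))

  clocks-sound : ∀ {m n} (gs : Vec (PR n) m) {t v ws} → clocks gs t v ≡ map suc ws → gs [ v ]⇓* ws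
  clocks-sound [] {ws = []} eq = []
  clocks-sound (g ∷ gs) {ws = w ∷ ws} eq = clock-sound g (cong head eq) ∷ clocks-sound gs (cong tail eq)

  primClock-sound : ∀ {n} (f : PR n) g k {t v y} → primClock f g t k v ≡ suc y → prim f g [ k ∷ v ]⇓ y
  primClock-sound f g zero eq = prim0 (clock-sound f eq)
  primClock-sound f g (suc k) {t} {v} eq with guardedPred⁻¹ (λ z → clock g t (k ∷ z ∷ v)) (primClock f g t k v) eq
  ... | z , e₁ , e₂ = primS (primClock-sound f g k e₁) (clock-sound g e₂)

running-mono : ∀ {n} (f : PR (suc n)) {t t′ j v} → t ≤ t′ → AtLeast2 (clock f t (j ∷ v)) → AtLeast2 (clock f t′ (j ∷ v))
running-mono f t≤t′ (m , e) = m , clock-mono f t≤t′ e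

mutual
  clock-complete : ∀ {n} {e : PR n} {v y} → e [ v ]⇓ y → Σ ℕ λ t → clock e t v ≡ suc y
  clock-complete Z⇓ = 0 , refl
  clock-complete S⇓ = 0 , refl
  clock-complete P⇓ = 0 , refl
  clock-complete (comp⇓ {f = f} {gs} {v} gs⇓ f⇓) with clocks-complete gs⇓ | clock-complete f⇓
  ... | t₁ , e₁ | t₂ , e₂ =
    t₁ ⊔ t₂ , guardedComp (clock f (t₁ ⊔ t₂)) _ (clocks-mono gs (m≤m⊔n t₁ t₂) e₁) (clock-mono f (m≤n⊔m t₁ t₂) e₂)
  clock-complete (prim0 f⇓) = clock-complete f⇓
  clock-complete (primS {f = f} {g} {k} {v} r⇓ g⇓) with clock-complete r⇓ | clock-complete g⇓
  ... | t₁ , e₁ | t₂ , e₂ =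
    t₁ ⊔ t₂ , guardedPred (λ z → clock g (t₁ ⊔ t₂) (k ∷ z ∷ v)) _
                          (primClock-mono f g k (m≤m⊔n t₁ t₂) e₁) (clock-mono g (m≤n⊔m t₁ t₂) e₂)
  clock-complete (mu⇓ {f = f} {v} {k} f⇓ below) with clock-complete f⇓ | clock-running f below
  ... | t₀ , e₀ | T , runningT =
    T′ , cong pred (search-found _ (λ j j<k → running-mono f T≤T′ (runningT j j<k)) (clock-mono f t₀≤T′ e₀) T′ (m≤m⊔n (suc k) (T ⊔ t₀)))
    where
    T′ = suc k ⊔ (T ⊔ t₀)
    T≤T′ : T ≤ T′
    T≤T′ = ≤-trans (m≤m⊔n T t₀) (m≤n⊔m (suc k) (T ⊔ t₀))
    t₀≤T′ : t₀ ≤ T′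
    t₀≤T′ = ≤-trans (m≤n⊔m T t₀) (m≤n⊔m (suc k) (T ⊔ t₀))

  clock-running : ∀ {n} (f : PR (suc n)) {v k} → (∀ j → j < k → Σ ℕ λ m → f [ j ∷ v ]⇓ suc m) →
                  Σ ℕ λ T → ∀ j → j < k → AtLeast2 (clock f T (j ∷ v))
  clock-running f {v} {k} below = commonBound (λ j t → AtLeast2 (clock f t (j ∷ v))) (λ j → running-mono f) k
    (λ j j<k → let (t , e) = clock-complete (proj₂ (below j j<k)) in t , proj₁ (below j j<k) , e)

  clocks-complete : ∀ {m n} {gs : Vec (PR n) m} {v ys} → gs [ v ]⇓* ys → Σ ℕ λ t → clocks gs t v ≡ map suc ys
  clocks-complete [] = 0 , refl
  clocks-complete (_∷_ {g = g} {gs} g⇓ gs⇓) with clock-complete g⇓ | clocks-complete gs⇓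
  ... | t₁ , e₁ | t₂ , e₂ = t₁ ⊔ t₂ , cong₂ _∷_ (clock-mono g (m≤m⊔n t₁ t₂) e₁) (clocks-mono gs (m≤n⊔m t₁ t₂) e₂)

-- Semideciders

Pos : ℕ → Set
Pos x = Σ ℕ λ m → x ≡ suc m

pos? : ∀ x → Dec (Pos x)
pos? zero = no λ ()
pos? (suc x) = yes (x , refl)

record Semidecider {k : ℕ} (A : Vec ℕ k → Set) : Set where
  field
    stage : Vec ℕ (suc k) → ℕ
    rec-stage : Recursive stage
    stage-mono : ∀ {t t′ v} → t ≤ t′ → Pos (stage (t ∷ v)) → Pos (stage (t′ ∷ v))
    semidecides : ∀ v → A v ⇔ (Σ ℕ λ t → Pos (stage (t ∷ v)))
open Semidecider

listable⇒semidecider : ∀ {k} {A : Vec ℕ k → Set} → Listable A → Semidecider A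
listable⇒semidecider (e , A⇔halts) = record
  { stage = Clock e
  ; rec-stage = rec-Clock e
  ; stage-mono = λ t≤t′ (y , eq) → y , clock-mono e t≤t′ eq
  ; semidecides = λ v → mk⇔ (λ a → let (y , e⇓) = to (A⇔halts v) a ; (t , eq) = clock-complete e⇓ in t , y , eq)
                            (λ { (t , y , eq) → from (A⇔halts v) (y , clock-sound e eq) }) }

minimalWitness : (Q : ℕ → Set) → (∀ n → Dec (Q n)) → ∀ t → Q t → Σ ℕ λ t₀ → Q t₀ × (∀ i → i < t₀ → ¬ Q i)
minimalWitness Q Q? t Qt with searchBelow (suc t)
  where
  searchBelow : ∀ n → (Σ ℕ λ t₀ → Q t₀ × (∀ i → i < t₀ → ¬ Q i)) ⊎ (∀ i → i < n → ¬ Q i)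
  searchBelow zero = inj₂ (λ i ())
  searchBelow (suc n) with searchBelow n
  ... | inj₁ found = inj₁ found
  ... | inj₂ none with Q? n
  ... | yes Qn = inj₁ (n , Qn , none)
  ... | no ¬Qn = inj₂ λ i i<1+n → [ none i , (λ { refl → ¬Qn }) ]′ (m≤n⇒m<n∨m≡n (s≤s⁻¹ i<1+n))
... | inj₁ found = found
... | inj₂ none = ⊥-elim (none t ≤-refl Qt)

semidecider⇒listable : ∀ {k} {A : Vec ℕ k → Set} → Semidecider A → Listable A
semidecider⇒listable {k} {A} sd = mu reject , λ v → mk⇔ (halts v) (accepted v)
  where
  rec-reject : Recursive (λ w → sgᶜ (stage sd w))
  rec-reject = rec-app₁ rec-sgᶜ (rec-stage sd)
  reject = proj₁ rec-reject
  reject⇓ = proj₂ rec-reject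
  halts : ∀ v → A v → Σ ℕ λ y → mu reject [ v ]⇓ y
  halts v a with to (semidecides sd v) a
  ... | t , accepts with minimalWitness (λ n → Pos (stage sd (n ∷ v))) (λ n → pos? _) t accepts
  ... | t₀ , (m , e) , before = t₀ , mu⇓ (subst (reject [ t₀ ∷ v ]⇓_) (cong sgᶜ e) (reject⇓ (t₀ ∷ v)))
                                         (λ i i<t₀ → 0 , subst (reject [ i ∷ v ]⇓_) (rejects i i<t₀) (reject⇓ (i ∷ v)))
    where
    rejects : ∀ i → i < t₀ → sgᶜ (stage sd (i ∷ v)) ≡ 1
    rejects i i<t₀ with stage sd (i ∷ v) in eq
    ... | zero = refl
    ... | suc x = ⊥-elim (before i i<t₀ (x , eq))
  accepted : ∀ v → (Σ ℕ λ y → mu reject [ v ]⇓ y) → A v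
  accepted v (y , mu⇓ reject⇓0 _) = from (semidecides sd v) (y , sgᶜ≡0⇒Pos (⇓-deterministic (reject⇓ (y ∷ v)) reject⇓0))
    where
    sgᶜ≡0⇒Pos : ∀ {x} → sgᶜ x ≡ 0 → Pos x
    sgᶜ≡0⇒Pos {suc x} _ = x , refl

sd-⇔ : ∀ {k} {A B : Vec ℕ k → Set} → (∀ v → A v ⇔ B v) → Semidecider A → Semidecider B
sd-⇔ A⇔B sd = record { stage = stage sd ; rec-stage = rec-stage sd ; stage-mono = stage-mono sd
  ; semidecides = λ v → mk⇔ (λ b → to (semidecides sd v) (from (A⇔B v) b)) (λ p → to (A⇔B v) (from (semidecides sd v) p)) }

pos-* : ∀ {a b} → Pos a → Pos b → Pos (a * b)
pos-* {suc m} {suc n} _ _ = n + m * suc n , refl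

pos-*⁻¹ : ∀ a b → Pos (a * b) → Pos a × Pos b
pos-*⁻¹ zero b (_ , ())
pos-*⁻¹ (suc a) zero (m , e) = ⊥-elim (0≢1+n (trans (sym (*-zeroʳ a)) e))
pos-*⁻¹ (suc a) (suc b) _ = (a , refl) , (b , refl)

pos-+ˡ : ∀ {a} b → Pos a → Pos (a + b)
pos-+ˡ b (m , refl) = m + b , refl

pos-+ʳ : ∀ a {b} → Pos b → Pos (a + b)
pos-+ʳ a {b} (m , refl) = a + m , +-suc a m

pos-+⁻¹ : ∀ a b → Pos (a + b) → Pos a ⊎ Pos b
pos-+⁻¹ zero b p = inj₂ p
pos-+⁻¹ (suc a) b _ = inj₁ (a , refl)

sd-∧ : ∀ {k} {A B : Vec ℕ k → Set} → Semidecider A → Semidecider B → Semidecider (λ v → A v × B v)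
sd-∧ {A = A} {B} sdA sdB = record
  { stage = λ w → stage sdA w * stage sdB w
  ; rec-stage = rec-app₂ rec-* (rec-stage sdA) (rec-stage sdB)
  ; stage-mono = λ {t} {t′} {v} t≤t′ p → let (pa , pb) = pos-*⁻¹ (stage sdA (t ∷ v)) (stage sdB (t ∷ v)) p
                                           in pos-* (stage-mono sdA t≤t′ pa) (stage-mono sdB t≤t′ pb)
  ; semidecides = λ v → mk⇔ (both v) (split v) }
  where
  both : ∀ v → A v × B v → Σ ℕ λ t → Pos (stage sdA (t ∷ v) * stage sdB (t ∷ v))
  both v (a , b) with to (semidecides sdA v) a | to (semidecides sdB v) b
  ... | t₁ , p₁ | t₂ , p₂ = t₁ ⊔ t₂ , pos-* (stage-mono sdA (m≤m⊔n t₁ t₂) p₁) (stage-mono sdB (m≤n⊔m t₁ t₂) p₂)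
  split : ∀ v → (Σ ℕ λ t → Pos (stage sdA (t ∷ v) * stage sdB (t ∷ v))) → A v × B v
  split v (t , p) with pos-*⁻¹ (stage sdA (t ∷ v)) (stage sdB (t ∷ v)) p
  ... | pa , pb = from (semidecides sdA v) (t , pa) , from (semidecides sdB v) (t , pb)

sd-∨ : ∀ {k} {A B : Vec ℕ k → Set} → Semidecider A → Semidecider B → Semidecider (λ v → A v ⊎ B v)
sd-∨ {A = A} {B} sdA sdB = record
  { stage = λ w → stage sdA w + stage sdB w
  ; rec-stage = rec-app₂ rec-+ (rec-stage sdA) (rec-stage sdB)
  ; stage-mono = λ {t} {t′} {v} t≤t′ p → [ (λ pa → pos-+ˡ (stage sdB (t′ ∷ v)) (stage-mono sdA t≤t′ pa))
                                         , (λ pb → pos-+ʳ (stage sdA (t′ ∷ v)) (stage-mono sdB t≤t′ pb)) ]′ (pos-+⁻¹ _ _ p)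
  ; semidecides = λ v → mk⇔ (either v) (which v) }
  where
  either : ∀ v → A v ⊎ B v → Σ ℕ λ t → Pos (stage sdA (t ∷ v) + stage sdB (t ∷ v))
  either v (inj₁ a) = let (t , p) = to (semidecides sdA v) a in t , pos-+ˡ _ p
  either v (inj₂ b) = let (t , p) = to (semidecides sdB v) b in t , pos-+ʳ _ p
  which : ∀ v → (Σ ℕ λ t → Pos (stage sdA (t ∷ v) + stage sdB (t ∷ v))) → A v ⊎ B v
  which v (t , p) with pos-+⁻¹ (stage sdA (t ∷ v)) _ p
  ... | inj₁ pa = inj₁ (from (semidecides sdA v) (t , pa))
  ... | inj₂ pb = inj₂ (from (semidecides sdB v) (t , pb))

sd-⊤ : ∀ {k} → Semidecider {k} (λ _ → ⊤)
sd-⊤ = record { stage = λ _ → 1 ; rec-stage = rec-const 1 ; stage-mono = λ _ p → p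
               ; semidecides = λ v → mk⇔ (λ _ → 0 , 0 , refl) (λ _ → tt) }

sd-∘ : ∀ {k m} {A : Vec ℕ m → Set} {g : Vec ℕ k → Vec ℕ m} → Semidecider A → RecursiveVec g → Semidecider (λ v → A (g v))
sd-∘ {g = g} sdA rec-g = record
  { stage = λ { (t ∷ v) → stage sdA (t ∷ g v) }
  ; rec-stage = rec-cong (λ { (t ∷ v) → refl }) (rec-∘ (rec-stage sdA) (recV-∷ (rec-proj zero) (recV-∘ rec-g recV-tail)))
  ; stage-mono = λ t≤t′ p → stage-mono sdA t≤t′ p
  ; semidecides = λ v → semidecides sdA (g v) }

partialSum : (ℕ → ℕ) → ℕ → ℕ
partialSum c zero = 0
partialSum c (suc n) = partialSum c n + c n

partialSum-pos⁻¹ : ∀ c n → Pos (partialSum c n) → Σ ℕ λ x → x < n × Pos (c x)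
partialSum-pos⁻¹ c zero (_ , ())
partialSum-pos⁻¹ c (suc n) p with pos-+⁻¹ (partialSum c n) (c n) p
... | inj₁ q = let (x , x<n , px) = partialSum-pos⁻¹ c n q in x , m<n⇒m<1+n x<n , px
... | inj₂ q = n , ≤-refl , q

partialSum-pos : ∀ c n x → x < n → Pos (c x) → Pos (partialSum c n)
partialSum-pos c (suc n) x x<1+n p with m≤n⇒m<n∨m≡n (s≤s⁻¹ x<1+n)
... | inj₁ x<n = pos-+ˡ (c n) (partialSum-pos c n x x<n p)
... | inj₂ refl = pos-+ʳ (partialSum c n) p

-- Dovetailing: at stage s, test the witnesses x ≤ s at stage s.
sd-∃ : ∀ {k} {A : Vec ℕ (suc k) → Set} → Semidecider A → Semidecider (λ v → Σ ℕ λ x → A (x ∷ v))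
sd-∃ {k} {A} sdA = record
  { stage = anyBelow
  ; rec-stage = rec-anyBelow
  ; stage-mono = anyBelow-mono
  ; semidecides = λ v → mk⇔ (accepted v) (witness v) }
  where
  anyBelow : Vec ℕ (suc k) → ℕ
  anyBelow (s ∷ v) = partialSum (λ x → stage sdA (s ∷ x ∷ v)) (suc s)
  step : Vec ℕ (3 + k) → ℕ
  step w = lookup w (suc zero) + stage sdA (lookup w (suc (suc zero)) ∷ lookup w zero ∷ tail (tail (tail w)))
  partialSum-by-primRec : ∀ s n v → primRec (λ _ → 0) step (n ∷ s ∷ v) ≡ partialSum (λ x → stage sdA (s ∷ x ∷ v)) n
  partialSum-by-primRec s zero v = refl
  partialSum-by-primRec s (suc n) v rewrite partialSum-by-primRec s n v = refl
  rec-anyBelow : Recursive anyBelow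
  rec-anyBelow = rec-cong (λ { (s ∷ v) → partialSum-by-primRec s (suc s) v })
    (rec-∘ (rec-primRec (rec-const 0) (rec-app₂ rec-+ (rec-proj (suc zero))
                                         (rec-∘ (rec-stage sdA) (recV-∷ (rec-proj (suc (suc zero))) (recV-∷ (rec-proj zero) recV-tail³)))))
           (recV-∷ (rec-app₁ rec-suc (rec-proj zero)) recV-id))
  anyBelow-mono : ∀ {t t′ v} → t ≤ t′ → Pos (anyBelow (t ∷ v)) → Pos (anyBelow (t′ ∷ v))
  anyBelow-mono {t} {t′} t≤t′ p with partialSum-pos⁻¹ _ (suc t) p
  ... | x , x≤t , px = partialSum-pos _ (suc t′) x (≤-trans x≤t (s≤s t≤t′)) (stage-mono sdA t≤t′ px)
  accepted : ∀ v → (Σ ℕ λ x → A (x ∷ v)) → Σ ℕ λ t → Pos (anyBelow (t ∷ v))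
  accepted v (x , a) with to (semidecides sdA (x ∷ v)) a
  ... | t , p = t ⊔ x , partialSum-pos _ (suc (t ⊔ x)) x (s≤s (m≤n⊔m t x)) (stage-mono sdA (m≤m⊔n t x) p)
  witness : ∀ v → (Σ ℕ λ t → Pos (anyBelow (t ∷ v))) → Σ ℕ λ x → A (x ∷ v)
  witness v (t , p) with partialSum-pos⁻¹ _ (suc t) p
  ... | x , _ , px = x , from (semidecides sdA (x ∷ v)) (t , px)

sd-∃Vec : ∀ j {k} {A : Vec ℕ (j + k) → Set} → Semidecider A → Semidecider (λ v → Σ (Vec ℕ j) λ u → A (u ++ v))
sd-∃Vec zero sdA = sd-⇔ (λ v → mk⇔ (λ a → [] , a) (λ { ([] , a) → a })) sdA
sd-∃Vec (suc j) {A = A} sdA = sd-⇔ (λ v → mk⇔ (λ { (u , x , a) → (x ∷ u) , a }) (λ { ((x ∷ u) , a) → u , x , a }))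
  (sd-∃Vec j {A = λ w → Σ ℕ λ x → A (x ∷ w)} (sd-∃ sdA))

sd-∃Vec-split : ∀ j {k} {B : Vec ℕ j → Vec ℕ k → Set} → Semidecider (λ w → B (take j w) (drop j w)) →
                Semidecider (λ v → Σ (Vec ℕ j) λ u → B u v)
sd-∃Vec-split j {B = B} sd = sd-⇔ (λ v → mk⇔ (λ { (u , b) → u , subst₂ B (take-++ u v) (drop-++ u v) b })
                                             (λ { (u , b) → u , subst₂ B (sym (take-++ u v)) (sym (drop-++ u v)) b }))
                                   (sd-∃Vec j sd)

sd-∀Fin : ∀ {r k} (A : Fin r → Vec ℕ k → Set) → (∀ i → Semidecider (A i)) → Semidecider (λ v → ∀ i → A i v)
sd-∀Fin {zero} A sdA = sd-⇔ (λ v → mk⇔ (λ _ ()) (λ _ → tt)) sd-⊤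
sd-∀Fin {suc r} A sdA = sd-⇔ (λ v → mk⇔ (λ { (a , as) → λ { zero → a ; (suc i) → as i } }) (λ as → as zero , λ i → as (suc i)))
  (sd-∧ (sdA zero) (sd-∀Fin (λ i → A (suc i)) (λ i → sdA (suc i))))

-- Enumerating listable sets

isLeq : ℕ → ℕ → ℕ
isLeq zero b = 1
isLeq (suc a) zero = 0
isLeq (suc a) (suc b) = isLeq a b

sgᶜ∸≡isLeq : ∀ a b → sgᶜ (a ∸ b) ≡ isLeq a b
sgᶜ∸≡isLeq zero zero = refl
sgᶜ∸≡isLeq zero (suc b) = refl
sgᶜ∸≡isLeq (suc a) zero = refl
sgᶜ∸≡isLeq (suc a) (suc b) = sgᶜ∸≡isLeq a b

rec-isLeq : Recursive (binary isLeq)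
rec-isLeq = rec-cong (λ { (a ∷ b ∷ []) → sgᶜ∸≡isLeq a b }) (rec-app₁ rec-sgᶜ (rec-app₂ rec-∸ (rec-proj zero) (rec-proj (suc zero))))

isLeq-≤ : ∀ {a b} → a ≤ b → isLeq a b ≡ 1
isLeq-≤ {zero} _ = refl
isLeq-≤ {suc a} {suc b} (s≤s le) = isLeq-≤ le

isLeq-> : ∀ {a b} → b < a → isLeq a b ≡ 0
isLeq-> {suc a} {zero} _ = refl
isLeq-> {suc a} {suc b} (s≤s lt) = isLeq-> lt

sq : ℕ → ℕ
sq k = k * k

isqrt : ℕ → ℕ
isqrt zero = 0
isqrt (suc n) = isqrt n + isLeq (sq (suc (isqrt n))) (suc n)

sq-suc : ∀ k → suc (sq k) ≤ sq (suc k)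
sq-suc k = s≤s (subst (k * k ≤_) (sym (cong (k +_) (*-suc k k))) (≤-trans (m≤n+m (k * k) k) (m≤n+m (k + k * k) k)))

isqrt-spec : ∀ n → sq (isqrt n) ≤ n × n < sq (suc (isqrt n))
isqrt-spec zero = z≤n , s≤s z≤n
isqrt-spec (suc n) with isqrt-spec n | sq (suc (isqrt n)) ≤? suc n
... | (lower , upper) | yes next≤ rewrite isLeq-≤ next≤ | +-comm (isqrt n) 1 =
  next≤ , ≤-trans (s≤s upper) (sq-suc (suc (isqrt n)))
... | (lower , upper) | no next≰ rewrite isLeq-> (≰⇒> next≰) | +-identityʳ (isqrt n) =
  ≤-trans lower (n≤1+n n) , ≰⇒> next≰

sq-mono : ∀ {a b} → a ≤ b → sq a ≤ sq b
sq-mono a≤b = *-mono-≤ a≤b a≤b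

isqrt-unique : ∀ {n k K} → sq k ≤ n → n < sq (suc k) → sq K ≤ n → n < sq (suc K) → k ≡ K
isqrt-unique {n} {k} {K} k²≤n n<[1+k]² K²≤n n<[1+K]² with <-cmp k K
... | tri< k<K _ _ = ⊥-elim (<-irrefl refl (≤-trans n<[1+k]² (≤-trans (sq-mono k<K) K²≤n)))
... | tri≈ _ k≡K _ = k≡K
... | tri> _ _ k>K = ⊥-elim (<-irrefl refl (≤-trans n<[1+K]² (≤-trans (sq-mono k>K) k²≤n)))

isqrt-pair : ∀ a b → isqrt (sq (a + b) + a) ≡ a + b
isqrt-pair a b = isqrt-unique (proj₁ (isqrt-spec n)) (proj₂ (isqrt-spec n)) (m≤m+n (sq K) a) n<[1+K]²
  where
  K = a + b
  n = sq K + a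
  expand : ∀ K → suc K * suc K ≡ suc (K * K + K) + K
  expand = solve-∀
  n<[1+K]² : n < sq (suc K)
  n<[1+K]² = ≤-trans (s≤s (+-monoʳ-≤ (sq K) (m≤m+n a b))) (≤-trans (m≤m+n (suc (K * K + K)) K) (≤-reflexive (sym (expand K))))

-- Inverse of the pairing (a , b) ↦ (a + b)² + a.
unpair₁ : ℕ → ℕ
unpair₁ n = n ∸ sq (isqrt n)

unpair₂ : ℕ → ℕ
unpair₂ n = isqrt n ∸ unpair₁ n

unpair-surjective : ∀ a b → Σ ℕ λ n → unpair₁ n ≡ a × unpair₂ n ≡ b
unpair-surjective a b = sq (a + b) + a , unpair₁≡a , trans (cong₂ _∸_ (isqrt-pair a b) unpair₁≡a) (m+n∸m≡n a b)
  where
  unpair₁≡a : unpair₁ (sq (a + b) + a) ≡ a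
  unpair₁≡a = trans (cong (λ z → sq (a + b) + a ∸ sq z) (isqrt-pair a b)) (m+n∸m≡n (sq (a + b)) a)

rec-isqrt : Recursive (unary isqrt)
rec-isqrt = rec-cong isqrt-by-primRec (rec-primRec (rec-const 0) rec-step)
  where
  step : Vec ℕ 2 → ℕ
  step w = lookup w (suc zero) + isLeq (suc (lookup w (suc zero)) * suc (lookup w (suc zero))) (suc (lookup w zero))
  rec-root+1 = rec-app₁ rec-suc (rec-proj (suc zero))
  rec-step : Recursive step
  rec-step = rec-app₂ rec-+ (rec-proj (suc zero)) (rec-app₂ rec-isLeq (rec-app₂ rec-* rec-root+1 rec-root+1) (rec-app₁ rec-suc (rec-proj zero)))
  isqrt-by-primRec : ∀ v → primRec (λ _ → 0) step v ≡ unary isqrt v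
  isqrt-by-primRec (zero ∷ []) = refl
  isqrt-by-primRec (suc n ∷ []) rewrite isqrt-by-primRec (n ∷ []) = refl

rec-unpair₁ : Recursive (unary unpair₁)
rec-unpair₁ = rec-cong (λ { (n ∷ []) → refl })
  (rec-app₂ rec-∸ (rec-proj zero) (rec-app₂ rec-* (rec-app₁ rec-isqrt (rec-proj zero)) (rec-app₁ rec-isqrt (rec-proj zero))))

rec-unpair₂ : Recursive (unary unpair₂)
rec-unpair₂ = rec-cong (λ { (n ∷ []) → refl }) (rec-app₂ rec-∸ (rec-app₁ rec-isqrt (rec-proj zero)) (rec-app₁ rec-unpair₁ (rec-proj zero)))

unpairVec : ∀ k → ℕ → Vec ℕ k
unpairVec zero n = []
unpairVec (suc k) n = unpair₁ n ∷ unpairVec k (unpair₂ n)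

recV-unpairVec : ∀ k → RecursiveVec (λ (w : Vec ℕ 1) → unpairVec k (head w))
recV-unpairVec zero = recV-[]
recV-unpairVec (suc k) = recV-∷ (rec-app₁ rec-unpair₁ rec-head) (recV-∘ (recV-unpairVec k) (recV-∷ (rec-app₁ rec-unpair₂ rec-head) recV-[]))

unpairVec-surjective : ∀ k (v : Vec ℕ k) → Σ ℕ λ n → unpairVec k n ≡ v
unpairVec-surjective zero [] = 0 , refl
unpairVec-surjective (suc k) (x ∷ v) with unpairVec-surjective k v
... | m , unpair-m with unpair-surjective x m
... | n , unpair₁-n , unpair₂-n = n , cong₂ _∷_ unpair₁-n (trans (cong (unpairVec k) unpair₂-n) unpair-m)

record Enumeration {k} (A : Vec ℕ k → Set) : Set where
  field
    enum : ℕ → Vec ℕ k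
    rec-enum : RecursiveVec (λ (w : Vec ℕ 1) → enum (head w))
    enum-sound : ∀ n → A (enum n)
    enum-complete : ∀ v → A v → Σ ℕ λ n → enum n ≡ v
open Enumeration

ifPos : ∀ {k} → ℕ → Vec ℕ k → Vec ℕ k → Vec ℕ k
ifPos c x a = tabulate (λ i → sg c * lookup x i + sgᶜ c * lookup a i)

ifPos-zero : ∀ {k} (x a : Vec ℕ k) → ifPos 0 x a ≡ a
ifPos-zero x a = trans (tabulate-cong (λ i → +-identityʳ (lookup a i))) (tabulate∘lookup a)

ifPos-suc : ∀ {k} c (x a : Vec ℕ k) → ifPos (suc c) x a ≡ x
ifPos-suc c x a = trans (tabulate-cong (λ i → trans (+-identityʳ _) (+-identityʳ (lookup x i)))) (tabulate∘lookup x)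

-- The n-th element decodes n as a pair (t , v) and outputs v if it is accepted at stage t,
-- and the fixed element a otherwise. Only the fields are ever used, and keeping the
-- definition abstract spares the type checker from unfolding it.
abstract
  enumerate : ∀ {k} {A : Vec ℕ k → Set} → Semidecider A → (a : Vec ℕ k) → A a → Enumeration A
  enumerate {k} {A} sd a Aa = record { enum = candidate ; rec-enum = rec-candidate ; enum-sound = candidate-sound ; enum-complete = candidate-complete }
    where
    candidate : ℕ → Vec ℕ k
    candidate n = ifPos (stage sd (unpairVec (suc k) n)) (tail (unpairVec (suc k) n)) a
    rec-decode : RecursiveVec (λ (w : Vec ℕ 1) → unpairVec (suc k) (head w))
    rec-decode = recV-unpairVec (suc k)
    rec-candidate : RecursiveVec (λ (w : Vec ℕ 1) → candidate (head w))
    rec-candidate = recV-tabulate _ λ i →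
      rec-app₂ rec-+ (rec-app₂ rec-* (rec-app₁ rec-sg (rec-∘ (rec-stage sd) rec-decode)) (recV-lookup (recV-∘ recV-tail rec-decode) i))
                     (rec-app₂ rec-* (rec-app₁ rec-sgᶜ (rec-∘ (rec-stage sd) rec-decode)) (rec-const (lookup a i)))
    candidate-sound : ∀ n → A (candidate n)
    candidate-sound n with stage sd (unpairVec (suc k) n) in accepted
    ... | zero = subst A (sym (ifPos-zero (tail (unpairVec (suc k) n)) a)) Aa
    ... | suc c = subst A (sym (ifPos-suc c (tail (unpairVec (suc k) n)) a)) (from (semidecides sd _) (unpair₁ n , c , accepted))
    candidate-complete : ∀ v → A v → Σ ℕ λ n → candidate n ≡ v
    candidate-complete v Av with to (semidecides sd v) Av
    ... | t , c , accepted with unpairVec-surjective (suc k) (t ∷ v)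
    ... | n , decode-n = n , trans (cong (λ w → ifPos (stage sd w) (tail w) a) decode-n)
                                   (trans (cong (λ z → ifPos z v a) accepted) (ifPos-suc c v a))

-- Listability of p.e. definable sets

module ListableUnder {L : Language} (𝔐 : Structure L) (π : ListablePresentation 𝔐) where
  open Language L
  open Structure 𝔐 renaming (Carrier to M)

  ρπ : ℕ → M
  ρπ = ρ π

  ρπ-surjectiveVec : ∀ {k} (xs : Vec M k) → Σ (Vec ℕ k) λ ys → map ρπ ys ≡ xs
  ρπ-surjectiveVec [] = [] , refl
  ρπ-surjectiveVec (x ∷ xs) with surj π x | ρπ-surjectiveVec xs
  ... | n , e | ys , es = (n ∷ ys) , cong₂ _∷_ e es

  sd-ρπ≡ : ∀ {n} {a b : Vec ℕ n → ℕ} → Recursive a → Recursive b → Semidecider (λ w → ρπ (a w) ≡ ρπ (b w))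
  sd-ρπ≡ rec-a rec-b = sd-∘ (listable⇒semidecider (eqL π)) (recV-∷ rec-a (recV-∷ rec-b recV-[]))

  mutual
    sd-term : ∀ {n} (t : Term n) → Semidecider (λ (w : Vec ℕ (suc n)) → ρπ (head w) ≡ evalT 𝔐 t (map ρπ (tail w)))
    sd-term (var i) = sd-⇔ (λ w → mk⇔ (λ e → trans e (sym (lookup-map i ρπ (tail w)))) (λ e → trans e (lookup-map i ρπ (tail w))))
                        (sd-ρπ≡ rec-head (rec-∘ (rec-proj i) recV-tail))
    sd-term {n} (app f ts) = sd-⇔ iff (sd-∃Vec-split (farity f) {B = Spec} (sd-∧ sd-graph sd-args))
      where
      k = farity f
      Spec : Vec ℕ k → Vec ℕ (suc n) → Set
      Spec u w = graph 𝔐 f (ρπ (head w) ∷ map ρπ u) × map ρπ u ≡ evalTs 𝔐 ts (map ρπ (tail w))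
      sd-graph : Semidecider (λ w → graph 𝔐 f (ρπ (head (drop k w)) ∷ map ρπ (take k w)))
      sd-graph = sd-∘ (listable⇒semidecider (funL π f)) (recV-∷ (rec-∘ rec-head (recV-drop k)) (recV-take k))
      sd-args : Semidecider (λ w → map ρπ (take k w) ≡ evalTs 𝔐 ts (map ρπ (tail (drop k w))))
      sd-args = sd-terms′ ts (recV-take k) (recV-∘ recV-tail (recV-drop k))
      iff : ∀ w → (Σ (Vec ℕ k) λ u → Spec u w) ⇔ (ρπ (head w) ≡ fun f (evalTs 𝔐 ts (map ρπ (tail w))))
      iff w = mk⇔ (λ { (u , g , e) → trans g (cong (fun f) e) })
                  (λ e → let (u , eu) = ρπ-surjectiveVec (evalTs 𝔐 ts (map ρπ (tail w))) in u , trans e (cong (fun f) (sym eu)) , eu)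

    sd-terms : ∀ {n k} (ts : Vec (Term n) k) → Semidecider (λ (w : Vec ℕ (k + n)) → map ρπ (take k w) ≡ evalTs 𝔐 ts (map ρπ (drop k w)))
    sd-terms [] = sd-⇔ (λ w → mk⇔ (λ _ → refl) (λ _ → tt)) sd-⊤
    sd-terms {n} {suc k} (t ∷ ts) =
      sd-⇔ (λ { (x ∷ w) → ×⇔∷≡∷ }) (sd-∧ (sd-∘ (sd-term t) (recV-∷ rec-head (recV-drop (suc k)))) (sd-∘ (sd-terms ts) recV-tail))

    sd-terms′ : ∀ {n m k} (ts : Vec (Term n) k) {a : Vec ℕ m → Vec ℕ k} {b : Vec ℕ m → Vec ℕ n} → RecursiveVec a → RecursiveVec b →
                Semidecider (λ w → map ρπ (a w) ≡ evalTs 𝔐 ts (map ρπ (b w)))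
    sd-terms′ {n} {k = k} ts {a} {b} rec-a rec-b = sd-⇔ (λ w → mk⇔ (subst₂ Eval (take-++ (a w) (b w)) (drop-++ (a w) (b w)))
                                                                (subst₂ Eval (sym (take-++ (a w) (b w))) (sym (drop-++ (a w) (b w)))))
                                                      (sd-∘ (sd-terms ts) (recV-++ rec-a rec-b))
      where
      Eval : Vec ℕ k → Vec ℕ n → Set
      Eval x y = map ρπ x ≡ evalTs 𝔐 ts (map ρπ y)

  sd-formula : ∀ {n} (φ : PEFormula n) → Semidecider (λ (v : Vec ℕ n) → Sat 𝔐 φ (map ρπ v))
  sd-formula (s ≐ t) = sd-⇔ iff (sd-∃ (sd-∧ (sd-term s) (sd-term t)))
    where
    iff : ∀ v → (Σ ℕ λ y → ρπ y ≡ evalT 𝔐 s (map ρπ v) × ρπ y ≡ evalT 𝔐 t (map ρπ v)) ⇔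
                (evalT 𝔐 s (map ρπ v) ≡ evalT 𝔐 t (map ρπ v))
    iff v = mk⇔ (λ { (y , a , b) → trans (sym a) b })
                (λ e → let (y , ey) = surj π (evalT 𝔐 s (map ρπ v)) in y , ey , trans ey e)
  sd-formula {n} (relA R ts) = sd-⇔ iff (sd-∃Vec-split (rarity R) {B = Spec} (sd-∧ sd-rel (sd-terms ts)))
    where
    k = rarity R
    Spec : Vec ℕ k → Vec ℕ n → Set
    Spec u v = rel R (map ρπ u) × map ρπ u ≡ evalTs 𝔐 ts (map ρπ v)
    sd-rel : Semidecider (λ w → rel R (map ρπ (take k w)))
    sd-rel = sd-∘ (listable⇒semidecider (relL π R)) (recV-take k)
    iff : ∀ v → (Σ (Vec ℕ k) λ u → Spec u v) ⇔ rel R (evalTs 𝔐 ts (map ρπ v))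
    iff v = mk⇔ (λ { (u , r , e) → subst (rel R) e r })
                (λ r → let (u , eu) = ρπ-surjectiveVec (evalTs 𝔐 ts (map ρπ v)) in u , subst (rel R) (sym eu) r , eu)
  sd-formula (φ ∧ ψ) = sd-∧ (sd-formula φ) (sd-formula ψ)
  sd-formula (φ ∨ ψ) = sd-∨ (sd-formula φ) (sd-formula ψ)
  sd-formula (ex φ) = sd-⇔ iff (sd-∃ (sd-formula φ))
    where
    iff : ∀ v → (Σ ℕ λ x → Sat 𝔐 φ (ρπ x ∷ map ρπ v)) ⇔ (Σ M λ a → Sat 𝔐 φ (a ∷ map ρπ v))
    iff v = mk⇔ (λ { (x , s) → ρπ x , s })
                (λ { (a , s) → let (x , e) = surj π a in x , subst (λ z → Sat 𝔐 φ (z ∷ map ρπ v)) (sym e) s })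

  sd-definable : ∀ {r} {X : Vec M r → Set} → PEDefinable 𝔐 X → Semidecider (pullℕ 𝔐 ρπ X)
  sd-definable (φ , h) = sd-⇔ (λ v → mk⇔ (from (h (map ρπ v))) (to (h (map ρπ v)))) (sd-formula φ)

-- The presentation induced by an interpretation

concat-injective : ∀ {A : Set} {p q} (xss yss : Vec (Vec A p) q) → concat xss ≡ concat yss → xss ≡ yss
concat-injective [] [] e = refl
concat-injective (xs ∷ xss) (ys ∷ yss) e = cong₂ _∷_ (++-injectiveˡ xs ys e) (concat-injective xss yss (++-injectiveʳ xs ys e))

θ-cong : ∀ {L K} {𝔄 : Structure L} {𝔅 : Structure K} (α : PEInterpretation 𝔄 𝔅) {x y} (dx : dom α x) (dy : dom α y) →
         x ≡ y → θ α x dx ≡ θ α y dy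
θ-cong α dx dy refl = θ-irr α _ dx dy

-- γ n is the image under α of the n-th code of a tuple in dom α; the element b₀ only serves
-- to make dom α nonempty, so that it has an enumeration.
module InducedPresentation {L K : Language} (𝔄 : Structure L) (𝔅 : Structure K) (π : ListablePresentation 𝔄)
                           (α : PEInterpretation 𝔄 𝔅) (b₀ : Structure.Carrier 𝔅) where
  open ListableUnder 𝔄 π
  private
    A = Structure.Carrier 𝔄
    B = Structure.Carrier 𝔅
    r = rank α

  sd-dom : Semidecider (λ v → dom α (map ρπ v))
  sd-dom = sd-definable (domDef α)

  sample = surj α b₀
  sampleCode = proj₁ (ρπ-surjectiveVec (proj₁ sample))
  sampleCode-inDom : dom α (map ρπ sampleCode)
  sampleCode-inDom = subst (dom α) (sym (proj₂ (ρπ-surjectiveVec (proj₁ sample)))) (proj₁ (proj₂ sample))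

  domEnum : Enumeration (λ v → dom α (map ρπ v))
  domEnum = enumerate sd-dom sampleCode sampleCode-inDom

  γ : ℕ → B
  γ n = θ α (map ρπ (enum domEnum n)) (enum-sound domEnum n)

  codes : ∀ {k} → Vec ℕ k → Vec ℕ (k * r)
  codes ns = concat (map (enum domEnum) ns)

  recV-codes : ∀ {k} → RecursiveVec (λ (ns : Vec ℕ k) → codes ns)
  recV-codes {zero} = recV-cong (λ { [] → refl }) recV-[]
  recV-codes {suc k} = recV-cong (λ { (n ∷ ns) → refl }) (recV-++ (recV-∘ (rec-enum domEnum) (recV-∷ rec-head recV-[])) (recV-∘ (recV-codes {k}) recV-tail))

  codes-inDom : ∀ {k} (ns : Vec ℕ k) → All (dom α) (map (λ n → map ρπ (enum domEnum n)) ns)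
  codes-inDom [] = []
  codes-inDom (n ∷ ns) = enum-sound domEnum n ∷ codes-inDom ns

  applyAll-codes : ∀ {k} (ns : Vec ℕ k) → applyAll 𝔄 𝔅 (θ α) (map (λ n → map ρπ (enum domEnum n)) ns) (codes-inDom ns) ≡ map γ ns
  applyAll-codes [] = refl
  applyAll-codes (n ∷ ns) = cong (γ n ∷_) (applyAll-codes ns)

  concat-codes : ∀ {k} (ns : Vec ℕ k) → concat (map (λ n → map ρπ (enum domEnum n)) ns) ≡ map ρπ (codes ns)
  concat-codes [] = refl
  concat-codes (n ∷ ns) = trans (cong (map ρπ (enum domEnum n) ++_) (concat-codes ns)) (sym (map-++ ρπ (enum domEnum n) (codes ns)))

  applyAll-codes′ : ∀ {k} (ns : Vec ℕ k) (xss : Vec (Vec A r) k) (ds : All (dom α) xss) →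
          xss ≡ map (λ n → map ρπ (enum domEnum n)) ns → applyAll 𝔄 𝔅 (θ α) xss ds ≡ map γ ns
  applyAll-codes′ [] [] [] e = refl
  applyAll-codes′ (n ∷ ns) (xs ∷ xss) (d ∷ ds) e =
    cong₂ _∷_ (θ-cong α d (enum-sound domEnum n) (∷-injectiveˡ e)) (applyAll-codes′ ns xss ds (∷-injectiveʳ e))

  pullθ-codes : ∀ {k} (Sr : Vec B k → Set) (ns : Vec ℕ k) → Sr (map γ ns) ⇔ pullθ 𝔄 𝔅 (θ α) Sr (map ρπ (codes ns))
  pullθ-codes Sr ns = mk⇔ (λ s → map (λ n → map ρπ (enum domEnum n)) ns , concat-codes ns , codes-inDom ns , subst Sr (sym (applyAll-codes ns)) s)
                 (λ { (xss , e , ds , s) → subst Sr (applyAll-codes′ ns xss ds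
                        (concat-injective xss _ (trans e (sym (concat-codes ns))))) s })

  sd-pullθ : ∀ {k} (Sr : Vec B k → Set) → PEDefinable 𝔄 (pullθ 𝔄 𝔅 (θ α) Sr) → Semidecider (pullℕ 𝔅 γ Sr)
  sd-pullθ Sr def = sd-⇔ (λ ns → mk⇔ (from (pullθ-codes Sr ns)) (to (pullθ-codes Sr ns))) (sd-∘ (sd-definable def) recV-codes)

  γ-surjective : ∀ b → Σ ℕ λ n → γ n ≡ b
  γ-surjective b with surj α b
  ... | xs , d , e with ρπ-surjectiveVec xs
  ... | c , ec with enum-complete domEnum c (subst (dom α) (sym ec) d)
  ... | n , en≡ = n , trans (θ-cong α (enum-sound domEnum n) d (trans (cong (map ρπ) en≡) ec)) e

  presentation : ListablePresentation 𝔅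
  presentation = record
    { ρ = γ
    ; surj = γ-surjective
    ; eqL = semidecider⇒listable (sd-pullθ EqRel (eqDef α))
    ; funL = λ f → semidecider⇒listable (sd-pullθ (graph 𝔅 f) (funDef α f))
    ; relL = λ R → semidecider⇒listable (sd-pullθ (Structure.rel 𝔅 R) (relDef α R)) }

-- Comparing codes

chunks : ∀ q {p} {X : Set} → Vec X (q * p) → Vec (Vec X p) q
chunks zero w = []
chunks (suc q) {p} w = take p w ∷ chunks q (drop p w)

concat-chunks : ∀ q {p} {X : Set} (w : Vec X (q * p)) → concat (chunks q w) ≡ w
concat-chunks zero [] = refl
concat-chunks (suc q) {p} w = trans (cong (take p w ++_) (concat-chunks q (drop p w))) (take++drop≡id p w)

map-chunks : ∀ q {p} {X Y : Set} (f : X → Y) (w : Vec X (q * p)) → map (map f) (chunks q w) ≡ chunks q (map f w)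
map-chunks zero f w = refl
map-chunks (suc q) {p} f w = cong₂ _∷_ (sym (take-map f p w)) (trans (map-chunks q f (drop p w)) (cong (chunks q) (sym (drop-map f p w))))

chunks-concat : ∀ q {p} {X : Set} (xss : Vec (Vec X p) q) → chunks q (concat xss) ≡ xss
chunks-concat zero [] = refl
chunks-concat (suc q) {p} (xs ∷ xss) = cong₂ _∷_ (take-++ xs (concat xss)) (trans (cong (chunks q) (drop-++ xs (concat xss))) (chunks-concat q xss))

recV-chunk : ∀ q {p} (j : Fin q) → RecursiveVec (λ (w : Vec ℕ (q * p)) → lookup (chunks q w) j)
recV-chunk (suc q) {p} zero = recV-take p
recV-chunk (suc q) {p} (suc j) = recV-∘ (recV-chunk q j) (recV-drop p)

pullθ-EqRel : ∀ {L K} {𝔄 : Structure L} {𝔅 : Structure K} (α : PEInterpretation 𝔄 𝔅) (x y : Vec (Structure.Carrier 𝔄) (rank α)) →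
              pullθ 𝔄 𝔅 (θ α) EqRel (x ++ (y ++ [])) ⇔ (Σ (dom α x) λ dx → Σ (dom α y) λ dy → θ α x dx ≡ θ α y dy)
pullθ-EqRel {𝔄 = 𝔄} {𝔅} α x y = mk⇔ unpack (λ { (dx , dy , e) → (x ∷ y ∷ []) , refl , (dx ∷ dy ∷ []) , e })
  where
  unpack : pullθ 𝔄 𝔅 (θ α) EqRel (x ++ (y ++ [])) → Σ (dom α x) λ dx → Σ (dom α y) λ dy → θ α x dx ≡ θ α y dy
  unpack ((x′ ∷ y′ ∷ []) , e , (dx ∷ dy ∷ []) , s) with ++-injectiveˡ x′ x e | ++-injectiveˡ y′ y (++-injectiveʳ x′ x e)
  ... | refl | refl = dx , dy , s

module CodeComparison {L K : Language} (𝔄 : Structure L) (𝔅 : Structure K)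
                      (π : ListablePresentation 𝔄) (α : PEInterpretation 𝔄 𝔅) (b₀ : Structure.Carrier 𝔅) where
  private
    p = rank α

  module Via𝔅 = InducedPresentation 𝔄 𝔅 π α b₀
  open ListableUnder 𝔄 π

  γ = Via𝔅.γ
  code = enum Via𝔅.domEnum

  SameImage′ : ℕ → Vec ℕ p → Set
  SameImage′ m c = Σ (dom α (map ρπ (code m))) λ dx → Σ (dom α (map ρπ c)) λ dy → θ α (map ρπ (code m)) dx ≡ θ α (map ρπ c) dy

  SameImage : ℕ → Vec ℕ p → Set
  SameImage m c = pullθ 𝔄 𝔅 (θ α) EqRel (map ρπ (code m ++ (c ++ [])))

  SameImage⇔ : ∀ m c → SameImage m c ⇔ SameImage′ m c
  SameImage⇔ m c = mk⇔ (λ z → to (pullθ-EqRel α _ _) (subst (pullθ 𝔄 𝔅 (θ α) EqRel) map-split z))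
                       (λ z → subst (pullθ 𝔄 𝔅 (θ α) EqRel) (sym map-split) (from (pullθ-EqRel α _ _) z))
    where
    map-split : map ρπ (code m ++ (c ++ [])) ≡ map ρπ (code m) ++ (map ρπ c ++ [])
    map-split = trans (map-++ ρπ (code m) (c ++ [])) (cong (map ρπ (code m) ++_) (map-++ ρπ c []))

  sameImages⇒applyAll : ∀ {k} (ms : Vec ℕ k) (cs : Vec ℕ (k * p)) → (∀ j → SameImage′ (lookup ms j) (lookup (chunks k cs) j)) →
                        Σ (All (dom α) (map (map ρπ) (chunks k cs))) λ ds → applyAll 𝔄 𝔅 (θ α) _ ds ≡ map γ ms
  sameImages⇒applyAll [] cs same = [] , refl
  sameImages⇒applyAll (m ∷ ms) cs same with same zero | sameImages⇒applyAll ms (drop p cs) (λ j → same (suc j))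
  ... | dx , dy , e | ds , eds = (dy ∷ ds) , cong₂ _∷_ (trans (sym e) (θ-irr α _ dx (enum-sound Via𝔅.domEnum m))) eds

  applyAll⇒sameImages : ∀ {k} (ms : Vec ℕ k) (cs : Vec ℕ (k * p)) (ds : All (dom α) (map (map ρπ) (chunks k cs))) →
                        applyAll 𝔄 𝔅 (θ α) _ ds ≡ map γ ms → ∀ j → SameImage′ (lookup ms j) (lookup (chunks k cs) j)
  applyAll⇒sameImages (m ∷ ms) cs (d ∷ ds) e zero = enum-sound Via𝔅.domEnum m , d , sym (∷-injectiveˡ e)
  applyAll⇒sameImages (m ∷ ms) cs (d ∷ ds) e (suc j) = applyAll⇒sameImages ms (drop p cs) ds (∷-injectiveʳ e) j

  sd-SameImage : ∀ {n} {m : Vec ℕ n → ℕ} {c : Vec ℕ n → Vec ℕ p} → Recursive m → RecursiveVec c →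
                 Semidecider (λ w → SameImage (m w) (c w))
  sd-SameImage rec-m rec-c =
    sd-∘ (sd-definable (eqDef α)) (recV-++ (recV-∘ (rec-enum Via𝔅.domEnum) (recV-∷ rec-m recV-[])) (recV-++ rec-c recV-[]))

-- By uniqueness, the presentation of 𝔄 induced through α and then β is π up to a recursive
-- translation φ; so x₀ = (β • α)(x) becomes: ρπ x₀ = ρπ (φ n) for some n whose β-code has,
-- block by block, the same α-images as x.
module ΓListable {L K : Language} (𝔄 : Structure L) (𝔅 : Structure K)
                 (unique : ∀ π γ → EquivPres 𝔄 π γ) (b₀ : Structure.Carrier 𝔅)
                 (α : PEInterpretation 𝔄 𝔅) (β : PEInterpretation 𝔅 𝔄)
                 (π : ListablePresentation 𝔄) where
  private
    p = rank α
    q = rank β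

  open CodeComparison 𝔄 𝔅 π α b₀
  module Via𝔄 = InducedPresentation 𝔅 𝔄 Via𝔅.presentation β (ρ π 0)
  open ListableUnder 𝔄 π

  βcode = enum Via𝔄.domEnum

  φ : ℕ → ℕ
  φ = proj₁ (unique π Via𝔄.presentation)
  rec-φ : Recursive (unary φ)
  rec-φ = proj₁ (proj₁ (proj₂ (unique π Via𝔄.presentation))) , λ { (n ∷ []) → proj₂ (proj₁ (proj₂ (unique π Via𝔄.presentation))) n }
  γ≡ρπ∘φ : ∀ n → Via𝔄.γ n ≡ ρπ (φ n)
  γ≡ρπ∘φ = proj₂ (proj₂ (unique π Via𝔄.presentation))

  Γ : Vec ℕ (suc (q * p)) → Set
  Γ = pullℕ 𝔄 ρπ (GammaComp α β)

  Matches : ℕ → Vec ℕ (suc (q * p)) → Set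
  Matches n (c₀ ∷ cs) = ρπ c₀ ≡ ρπ (φ n) × (∀ j → SameImage (lookup (βcode n) j) (lookup (chunks q cs) j))

  matches⇔Γ : ∀ v → (Σ ℕ λ n → Matches n v) ⇔ Γ v
  matches⇔Γ (c₀ ∷ cs) = mk⇔ matches⇒Γ Γ⇒matches
    where
    xss = map (map ρπ) (chunks q cs)
    concat-xss : concat xss ≡ map ρπ cs
    concat-xss = trans (sym (map-concat ρπ (chunks q cs))) (cong (map ρπ) (concat-chunks q cs))
    matches⇒Γ : (Σ ℕ λ n → Matches n (c₀ ∷ cs)) → Γ (c₀ ∷ cs)
    matches⇒Γ (n , e₀ , same)
      with sameImages⇒applyAll (βcode n) cs (λ j → to (SameImage⇔ (lookup (βcode n) j) (lookup (chunks q cs) j)) (same j))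
    ... | ds , eds = xss , concat-xss , ds , d , trans e₀ (trans (sym (γ≡ρπ∘φ n)) (θ-cong β (enum-sound Via𝔄.domEnum n) d (sym eds)))
      where
      d : dom β (applyAll 𝔄 𝔅 (θ α) xss ds)
      d = subst (dom β) (sym eds) (enum-sound Via𝔄.domEnum n)
    Γ⇒matches : Γ (c₀ ∷ cs) → Σ ℕ λ n → Matches n (c₀ ∷ cs)
    Γ⇒matches (xss′ , e , ds′ , d , e₁) with concat-injective xss′ xss (trans e (sym concat-xss))
    ... | refl with ListableUnder.ρπ-surjectiveVec 𝔅 Via𝔅.presentation (applyAll 𝔄 𝔅 (θ α) xss ds′)
    ... | ms , ems with enum-complete Via𝔄.domEnum ms (subst (dom β) (sym ems) d)
    ... | n , βcode-n = n , trans e₁ (trans (θ-cong β d (enum-sound Via𝔄.domEnum n) images) (γ≡ρπ∘φ n)) ,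
                        λ j → from (SameImage⇔ (lookup (βcode n) j) (lookup (chunks q cs) j)) (applyAll⇒sameImages (βcode n) cs ds′ images j)
      where
      images : applyAll 𝔄 𝔅 (θ α) xss ds′ ≡ map γ (βcode n)
      images = trans (sym ems) (cong (map γ) (sym βcode-n))

  sd-Matches : Semidecider (λ w → Matches (head w) (tail w))
  sd-Matches = sd-⇔ (λ { (n ∷ c₀ ∷ cs) → mk⇔ (λ z → z) (λ z → z) })
    (sd-∧ (sd-ρπ≡ (rec-proj (suc zero)) (rec-app₁ rec-φ rec-head)) (sd-∀Fin _ sd-sameImage))
    where
    sd-sameImage : ∀ j → Semidecider (λ w → SameImage (lookup (βcode (head w)) j) (lookup (chunks q (tail (tail w))) j))
    sd-sameImage j = sd-SameImage (recV-lookup (recV-∘ (rec-enum Via𝔄.domEnum) (recV-∷ rec-head recV-[])) j)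
                                  (recV-∘ (recV-chunk q j) (recV-∘ recV-tail recV-tail))

  Γ-listable : Listable Γ
  Γ-listable = semidecider⇒listable (sd-⇔ matches⇔Γ (sd-∃ sd-Matches))

-- Codes of a tuple in θ*(X) are found by guessing codes ns ∈ X under the induced presentation
-- of 𝔅 and comparing images block by block.
module PullbackListable {L K : Language} (𝔄 : Structure L) (𝔅 : Structure K)
                        (π : ListablePresentation 𝔄) (α : PEInterpretation 𝔄 𝔅) (b₀ : Structure.Carrier 𝔅)
                        {r : ℕ} (X : Vec (Structure.Carrier 𝔅) r → Set) (X-total : TotallyListable 𝔅 X) where
  private
    p = rank α
  open CodeComparison 𝔄 𝔅 π α b₀
  open ListableUnder 𝔄 π

  Y : Vec ℕ (r * p) → Set
  Y cs = pullθ 𝔄 𝔅 (θ α) X (map ρπ cs)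

  Matches : Vec ℕ r → Vec ℕ (r * p) → Set
  Matches ns cs = X (map γ ns) × (∀ j → SameImage (lookup ns j) (lookup (chunks r cs) j))

  matches⇔Y : ∀ cs → (Σ (Vec ℕ r) λ ns → Matches ns cs) ⇔ Y cs
  matches⇔Y cs = mk⇔ matches⇒Y Y⇒matches
    where
    xss = map (map ρπ) (chunks r cs)
    concat-xss : concat xss ≡ map ρπ cs
    concat-xss = trans (sym (map-concat ρπ (chunks r cs))) (cong (map ρπ) (concat-chunks r cs))
    matches⇒Y : (Σ (Vec ℕ r) λ ns → Matches ns cs) → Y cs
    matches⇒Y (ns , x , same) with sameImages⇒applyAll ns cs (λ j → to (SameImage⇔ (lookup ns j) (lookup (chunks r cs) j)) (same j))
    ... | ds , eds = xss , concat-xss , ds , subst X (sym eds) x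
    Y⇒matches : Y cs → Σ (Vec ℕ r) λ ns → Matches ns cs
    Y⇒matches (xss′ , e , ds′ , x) with concat-injective xss′ xss (trans e (sym concat-xss))
    ... | refl with ListableUnder.ρπ-surjectiveVec 𝔅 Via𝔅.presentation (applyAll 𝔄 𝔅 (θ α) xss ds′)
    ... | ns , ens = ns , subst X (sym ens) x ,
                     λ j → from (SameImage⇔ (lookup ns j) (lookup (chunks r cs) j)) (applyAll⇒sameImages ns cs ds′ (sym ens) j)

  sd-Matches : Semidecider (λ w → Matches (take r w) (drop r w))
  sd-Matches = sd-∧ (sd-∘ (listable⇒semidecider (X-total Via𝔅.presentation)) (recV-take r))
                    (sd-∀Fin _ (λ j → sd-SameImage (recV-lookup (recV-take r) j) (recV-∘ (recV-chunk r j) (recV-drop r))))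

  Y-listable : Listable Y
  Y-listable = semidecider⇒listable (sd-⇔ matches⇔Y (sd-∃Vec-split r {B = Matches} sd-Matches))

-- P.e. definability

select : ∀ {m n} {X : Set} → (Fin m → Fin n) → Vec X n → Vec X m
select ρ v = tabulate (λ i → lookup v (ρ i))

-- A map natural in the entry type only rearranges entries, i.e. it is a select; so p.e.
-- definability is transported along it by renaming variables.
Natural : ∀ {n m} → (∀ {X : Set} → Vec X n → Vec X m) → Set₁
Natural g = ∀ {X Y : Set} (f : X → Y) v → g (map f v) ≡ map f (g v)

natural⇒select : ∀ {n m} (g : ∀ {X : Set} → Vec X n → Vec X m) → Natural g → ∀ {X : Set} (v : Vec X n) → g v ≡ select (lookup (g (allFin n))) v
natural⇒select {n} g nat v = trans (cong g (sym (map-lookup-allFin v))) (trans (nat (lookup v) (allFin n)) (sym (tabulate∘lookup-map (lookup v) (g (allFin n)))))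

lookup-chunks-natural : ∀ k {q} (i : Fin k) → Natural (λ {X} (w : Vec X (k * q)) → lookup (chunks k w) i)
lookup-chunks-natural k i f w = trans (cong (λ z → lookup z i) (sym (map-chunks k f w))) (lookup-map i (map f) (chunks k w))

module Definability {L : Language} (𝔄 : Structure L) where
  open Language L
  open Structure 𝔄 renaming (Carrier to A)

  mutual
    renameTerm : ∀ {m n} → (Fin m → Fin n) → Term {L} m → Term {L} n
    renameTerm ρ (var i) = var (ρ i)
    renameTerm ρ (app f ts) = app f (renameTerms ρ ts)

    renameTerms : ∀ {m n k} → (Fin m → Fin n) → Vec (Term {L} m) k → Vec (Term {L} n) k
    renameTerms ρ [] = []
    renameTerms ρ (t ∷ ts) = renameTerm ρ t ∷ renameTerms ρ ts

  mutual
    evalT-rename : ∀ {m n} (ρ : Fin m → Fin n) (t : Term {L} m) (v : Vec A n) → evalT 𝔄 (renameTerm ρ t) v ≡ evalT 𝔄 t (select ρ v)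
    evalT-rename ρ (var i) v = sym (lookup∘tabulate (λ i → lookup v (ρ i)) i)
    evalT-rename ρ (app f ts) v = cong (fun f) (evalTs-rename ρ ts v)

    evalTs-rename : ∀ {m n k} (ρ : Fin m → Fin n) (ts : Vec (Term {L} m) k) (v : Vec A n) → evalTs 𝔄 (renameTerms ρ ts) v ≡ evalTs 𝔄 ts (select ρ v)
    evalTs-rename ρ [] v = refl
    evalTs-rename ρ (t ∷ ts) v = cong₂ _∷_ (evalT-rename ρ t v) (evalTs-rename ρ ts v)

  renameFormula : ∀ {m n} → (Fin m → Fin n) → PEFormula {L} m → PEFormula {L} n
  renameFormula ρ (s ≐ t) = renameTerm ρ s ≐ renameTerm ρ t
  renameFormula ρ (relA R ts) = relA R (renameTerms ρ ts)
  renameFormula ρ (φ ∧ ψ) = renameFormula ρ φ ∧ renameFormula ρ ψ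
  renameFormula ρ (φ ∨ ψ) = renameFormula ρ φ ∨ renameFormula ρ ψ
  renameFormula ρ (ex φ) = ex (renameFormula (lift 1 ρ) φ)

  Sat-rename : ∀ {m n} (ρ : Fin m → Fin n) (φ : PEFormula {L} m) (v : Vec A n) → Sat 𝔄 (renameFormula ρ φ) v ⇔ Sat 𝔄 φ (select ρ v)
  Sat-rename ρ (s ≐ t) v = mk⇔ (λ e → trans (sym (evalT-rename ρ s v)) (trans e (evalT-rename ρ t v)))
                            (λ e → trans (evalT-rename ρ s v) (trans e (sym (evalT-rename ρ t v))))
  Sat-rename ρ (relA R ts) v = mk⇔ (subst (rel R) (evalTs-rename ρ ts v)) (subst (rel R) (sym (evalTs-rename ρ ts v)))
  Sat-rename ρ (φ ∧ ψ) v = mk⇔ (λ { (a , b) → to (Sat-rename ρ φ v) a , to (Sat-rename ρ ψ v) b })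
                            (λ { (a , b) → from (Sat-rename ρ φ v) a , from (Sat-rename ρ ψ v) b })
  Sat-rename ρ (φ ∨ ψ) v = mk⇔ (λ { (inj₁ a) → inj₁ (to (Sat-rename ρ φ v) a) ; (inj₂ b) → inj₂ (to (Sat-rename ρ ψ v) b) })
                            (λ { (inj₁ a) → inj₁ (from (Sat-rename ρ φ v) a) ; (inj₂ b) → inj₂ (from (Sat-rename ρ ψ v) b) })
  Sat-rename ρ (ex φ) v = mk⇔ (λ { (a , s) → a , to (Sat-rename (lift 1 ρ) φ (a ∷ v)) s })
                           (λ { (a , s) → a , from (Sat-rename (lift 1 ρ) φ (a ∷ v)) s })

  def-⇔ : ∀ {n} {X Y : Vec A n → Set} → (∀ v → X v ⇔ Y v) → PEDefinable 𝔄 X → PEDefinable 𝔄 Y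
  def-⇔ h (φ , d) = φ , λ v → mk⇔ (λ y → to (d v) (from (h v) y)) (λ s → to (h v) (from (d v) s))

  def-natural : ∀ {n m} (g : ∀ {X : Set} → Vec X n → Vec X m) → Natural g → {Y : Vec A m → Set} →
                PEDefinable 𝔄 Y → PEDefinable 𝔄 (λ v → Y (g v))
  def-natural {n} g nat {Y} (φ , d) = renameFormula ϱ φ , λ v → mk⇔
      (λ y → from (Sat-rename ϱ φ v) (subst (Sat 𝔄 φ) (natural⇒select g nat v) (to (d (g v)) y)))
      (λ s → from (d (g v)) (subst (Sat 𝔄 φ) (sym (natural⇒select g nat v)) (to (Sat-rename ϱ φ v) s)))
    where
    ϱ = lookup (g (allFin n))

  def-∧ : ∀ {n} {X Y : Vec A n → Set} → PEDefinable 𝔄 X → PEDefinable 𝔄 Y → PEDefinable 𝔄 (λ v → X v × Y v)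
  def-∧ (φ , d) (ψ , e) = (φ ∧ ψ) , λ v → mk⇔ (λ { (a , b) → to (d v) a , to (e v) b }) (λ { (a , b) → from (d v) a , from (e v) b })

  def-∨ : ∀ {n} {X Y : Vec A n → Set} → PEDefinable 𝔄 X → PEDefinable 𝔄 Y → PEDefinable 𝔄 (λ v → X v ⊎ Y v)
  def-∨ (φ , d) (ψ , e) = (φ ∨ ψ) , λ v → mk⇔ (λ { (inj₁ a) → inj₁ (to (d v) a) ; (inj₂ b) → inj₂ (to (e v) b) })
                                           (λ { (inj₁ a) → inj₁ (from (d v) a) ; (inj₂ b) → inj₂ (from (e v) b) })

  def-∃ : ∀ {n} {X : Vec A (suc n) → Set} → PEDefinable 𝔄 X → PEDefinable 𝔄 (λ v → Σ A λ a → X (a ∷ v))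
  def-∃ (φ , d) = ex φ , λ v → mk⇔ (λ { (a , x) → a , to (d (a ∷ v)) x }) (λ { (a , s) → a , from (d (a ∷ v)) s })

  def-∃Vec : ∀ j {n} {X : Vec A (j + n) → Set} → PEDefinable 𝔄 X → PEDefinable 𝔄 (λ v → Σ (Vec A j) λ u → X (u ++ v))
  def-∃Vec zero D = def-⇔ (λ v → mk⇔ (λ a → [] , a) (λ { ([] , a) → a })) D
  def-∃Vec (suc j) {X = X} D = def-⇔ (λ v → mk⇔ (λ { (u , x , a) → (x ∷ u) , a }) (λ { ((x ∷ u) , a) → u , x , a }))
    (def-∃Vec j {X = λ w → Σ A λ x → X (x ∷ w)} (def-∃ D))

  -- ⊤ is expressed as ∃x. x = x, which needs an element.
  def-⊤ : A → ∀ {n} → PEDefinable 𝔄 {n} (λ _ → ⊤)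
  def-⊤ a₀ = ex (var zero ≐ var zero) , λ v → mk⇔ (λ _ → a₀ , refl) (λ _ → tt)

  def-∀Fin : A → ∀ {r n} (X : Fin r → Vec A n → Set) → (∀ i → PEDefinable 𝔄 (X i)) → PEDefinable 𝔄 (λ v → ∀ i → X i v)
  def-∀Fin a₀ {zero} X h = def-⇔ (λ v → mk⇔ (λ _ ()) (λ _ → tt)) (def-⊤ a₀)
  def-∀Fin a₀ {suc r} X h = def-⇔ (λ v → mk⇔ (λ { (a , b) → λ { zero → a ; (suc i) → b i } }) (λ f → f zero , λ i → f (suc i)))
    (def-∧ (h zero) (def-∀Fin a₀ (λ i → X (suc i)) (λ i → h (suc i))))

-- Transfer along an interpretation

-- Applies xss ys: ys is the image of xss under θ coordinatewise, recorded as a vector of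
-- points of the graph of θ so that it commutes with rearrangements of coordinates.
module Application {L K : Language} {𝔄 : Structure L} {𝔅 : Structure K} (α : PEInterpretation 𝔄 𝔅) where
  private
    A = Structure.Carrier 𝔄
    B = Structure.Carrier 𝔅
    p = rank α

  GraphPoint : Set
  GraphPoint = Σ (Vec A p) λ x → Σ B λ b → Σ (dom α x) λ d → θ α x d ≡ b

  argument : GraphPoint → Vec A p
  argument w = proj₁ w
  value : GraphPoint → B
  value w = proj₁ (proj₂ w)

  Applies : ∀ {k} → Vec (Vec A p) k → Vec B k → Set
  Applies {k} xss ys = Σ (Vec GraphPoint k) λ ws → map argument ws ≡ xss × map value ws ≡ ys

  Applies-natural : ∀ {n m} (g : ∀ {X : Set} → Vec X n → Vec X m) → Natural g → ∀ {xss ys} → Applies xss ys → Applies (g xss) (g ys)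
  Applies-natural g nat (ws , e1 , e2) = g ws , trans (sym (nat argument ws)) (cong g e1) , trans (sym (nat value ws)) (cong g e2)

  graph-functional : ∀ {k} (ws ws′ : Vec GraphPoint k) → map argument ws ≡ map argument ws′ → map value ws ≡ map value ws′
  graph-functional [] [] e = refl
  graph-functional ((x , b , d , eb) ∷ ws) ((x′ , b′ , d′ , eb′) ∷ ws′) e =
    cong₂ _∷_ (trans (sym eb) (trans (θ-cong α d d′ (∷-injectiveˡ e)) eb′)) (graph-functional ws ws′ (∷-injectiveʳ e))

  Applies-functional : ∀ {k} {xss : Vec (Vec A p) k} {ys ys′} → Applies xss ys → Applies xss ys′ → ys ≡ ys′
  Applies-functional (ws , e1 , e2) (ws′ , e1′ , e2′) = trans (sym e2) (trans (graph-functional ws ws′ (trans e1 (sym e1′))) e2′)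

  Applies-[] : Applies [] []
  Applies-[] = [] , refl , refl

  Applies-∷ : ∀ {k x b} {xss : Vec (Vec A p) k} {ys} → (Σ (dom α x) λ d → θ α x d ≡ b) → Applies xss ys → Applies (x ∷ xss) (b ∷ ys)
  Applies-∷ {x = x} {b} (d , e) (ws , e1 , e2) = ((x , b , d , e) ∷ ws) , cong (x ∷_) e1 , cong (b ∷_) e2

  Applies-∷⁻¹ : ∀ {k x b} {xss : Vec (Vec A p) k} {ys} → Applies (x ∷ xss) (b ∷ ys) → (Σ (dom α x) λ d → θ α x d ≡ b) × Applies xss ys
  Applies-∷⁻¹ (((x , b , d , e) ∷ ws) , e1 , e2) with ∷-injectiveˡ e1 | ∷-injectiveˡ e2
  ... | refl | refl = (d , e) , ws , ∷-injectiveʳ e1 , ∷-injectiveʳ e2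

  Applies-surjective : ∀ {k} (ys : Vec B k) → Σ (Vec (Vec A p) k) λ xss → Applies xss ys
  Applies-surjective [] = [] , Applies-[]
  Applies-surjective (y ∷ ys) with surj α y | Applies-surjective ys
  ... | x , d , e | xss , a = (x ∷ xss) , Applies-∷ (d , e) a

  applyAll-Applies : ∀ {k} {xss : Vec (Vec A p) k} (ds : All (dom α) xss) → Applies xss (applyAll 𝔄 𝔅 (θ α) xss ds)
  applyAll-Applies [] = Applies-[]
  applyAll-Applies (d ∷ ds) = Applies-∷ (d , refl) (applyAll-Applies ds)

  Applies⇒applyAll : ∀ {k} {xss : Vec (Vec A p) k} {ys} → Applies xss ys → Σ (All (dom α) xss) λ ds → applyAll 𝔄 𝔅 (θ α) xss ds ≡ ys
  Applies⇒applyAll {xss = []} {[]} a = [] , refl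
  Applies⇒applyAll {xss = x ∷ xss} {y ∷ ys} a with Applies-∷⁻¹ a
  ... | (d , e) , a′ with Applies⇒applyAll a′
  ... | ds , eds = (d ∷ ds) , cong₂ _∷_ e eds

  dom⇒Applies : ∀ {k} {xss : Vec (Vec A p) k} → (∀ i → dom α (lookup xss i)) → Σ (Vec B k) λ ys → Applies xss ys
  dom⇒Applies {xss = []} h = [] , Applies-[]
  dom⇒Applies {xss = x ∷ xss} h with dom⇒Applies {xss = xss} (λ i → h (suc i))
  ... | ys , a = (θ α x (h zero) ∷ ys) , Applies-∷ (h zero , refl) a

  Applies⇒dom : ∀ {k} {xss : Vec (Vec A p) k} {ys} → Applies xss ys → ∀ i → dom α (lookup xss i)
  Applies⇒dom {xss = x ∷ xss} {y ∷ ys} a zero = proj₁ (proj₁ (Applies-∷⁻¹ a))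
  Applies⇒dom {xss = x ∷ xss} {y ∷ ys} a (suc i) = Applies⇒dom (proj₂ (Applies-∷⁻¹ a)) i

  Pullback : ∀ {k} → (Vec B k → Set) → Vec A (k * p) → Set
  Pullback {k} Q w = Σ (Vec B k) λ ys → Applies (chunks k w) ys × Q ys

  pullθ⇔Pullback : ∀ {k} (Q : Vec B k → Set) w → pullθ 𝔄 𝔅 (θ α) Q w ⇔ Pullback Q w
  pullθ⇔Pullback {k} Q w = mk⇔ fw bw
    where
    fw : pullθ 𝔄 𝔅 (θ α) Q w → Pullback Q w
    fw (xss , e , ds , s) with concat-injective xss (chunks k w) (trans e (sym (concat-chunks k w)))
    ... | refl = applyAll 𝔄 𝔅 (θ α) xss ds , applyAll-Applies ds , s
    bw : Pullback Q w → pullθ 𝔄 𝔅 (θ α) Q w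
    bw (ys , a , s) with Applies⇒applyAll a
    ... | ds , eds = chunks k w , concat-chunks k w , ds , subst Q (sym eds) s

  Applies-lookup : ∀ {k} {xss : Vec (Vec A p) k} {ys} → Applies xss ys → ∀ i → Σ (dom α (lookup xss i)) λ d → θ α (lookup xss i) d ≡ lookup ys i
  Applies-lookup {xss = x ∷ xss} {y ∷ ys} a zero = proj₁ (Applies-∷⁻¹ a)
  Applies-lookup {xss = x ∷ xss} {y ∷ ys} a (suc i) = Applies-lookup (proj₂ (Applies-∷⁻¹ a)) i

module Transfer {L K : Language} (𝔄 : Structure L) (𝔅 : Structure K) (α : PEInterpretation 𝔄 𝔅) (a₀ : Structure.Carrier 𝔄) where
  open Definability 𝔄
  open Application α
  private
    A = Structure.Carrier 𝔄
    B = Structure.Carrier 𝔅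
    p = rank α

  Transferable : ∀ {k} → (Vec B k → Set) → Set
  Transferable Q = PEDefinable 𝔄 (Pullback Q)

  tr-pullθ : ∀ {k} {Q : Vec B k → Set} → PEDefinable 𝔄 (pullθ 𝔄 𝔅 (θ α) Q) → Transferable Q
  tr-pullθ {Q = Q} D = def-⇔ (λ w → pullθ⇔Pullback Q w) D

  tr-⇔ : ∀ {k} {Q Q′ : Vec B k → Set} → (∀ v → Q v ⇔ Q′ v) → Transferable Q → Transferable Q′
  tr-⇔ h = def-⇔ (λ w → mk⇔ (λ { (ys , a , s) → ys , a , to (h ys) s }) (λ { (ys , a , s) → ys , a , from (h ys) s }))

  tr-∧ : ∀ {k} {Q Q′ : Vec B k → Set} → Transferable Q → Transferable Q′ → Transferable (λ v → Q v × Q′ v)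
  tr-∧ {Q′ = Q′} D D′ = def-⇔ (λ w → mk⇔ (λ { ((ys , a , s) , (ys′ , a′ , s′)) → ys , a , s , subst Q′ (sym (Applies-functional a a′)) s′ })
                                        (λ { (ys , a , s , s′) → (ys , a , s) , (ys , a , s′) }))
                             (def-∧ D D′)

  tr-∨ : ∀ {k} {Q Q′ : Vec B k → Set} → Transferable Q → Transferable Q′ → Transferable (λ v → Q v ⊎ Q′ v)
  tr-∨ D D′ = def-⇔ (λ w → mk⇔ (λ { (inj₁ (ys , a , s)) → ys , a , inj₁ s ; (inj₂ (ys , a , s)) → ys , a , inj₂ s })
                              (λ { (ys , a , inj₁ s) → inj₁ (ys , a , s) ; (ys , a , inj₂ s) → inj₂ (ys , a , s) }))
                   (def-∨ D D′)

  def-allInDom : ∀ {k} → PEDefinable 𝔄 (λ (w : Vec A (k * p)) → ∀ i → dom α (lookup (chunks k w) i))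
  def-allInDom {k} = def-∀Fin a₀ _ (λ i → def-natural (λ w → lookup (chunks k w) i) (lookup-chunks-natural k i) (domDef α))

  tr-⊤ : ∀ {k} → Transferable {k} (λ _ → ⊤)
  tr-⊤ = def-⇔ (λ w → mk⇔ (λ h → let (ys , a) = dom⇒Applies h in ys , a , tt) (λ { (ys , a , _) → Applies⇒dom a })) def-allInDom

  tr-natural : ∀ {n m} (g : ∀ {X : Set} → Vec X n → Vec X m) → Natural g → {Q : Vec B m → Set} → Transferable Q → Transferable (λ ys → Q (g ys))
  tr-natural {n} {m} g nat {Q} Q-def = def-⇔ iff (def-∧ (def-natural regroup regroup-natural Q-def) def-allInDom)
    where
    regroup : ∀ {X : Set} → Vec X (n * p) → Vec X (m * p)
    regroup w = concat (g (chunks n w))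
    regroup-natural : Natural regroup
    regroup-natural f w = sym (trans (map-concat f (g (chunks n w))) (cong concat (trans (sym (nat (map f) (chunks n w))) (cong g (map-chunks n f w)))))
    chunks-regroup : ∀ w → chunks m (regroup w) ≡ g (chunks n w)
    chunks-regroup w = chunks-concat m (g (chunks n w))
    iff : ∀ w → (Pullback Q (regroup w) × (∀ i → dom α (lookup (chunks n w) i))) ⇔ Pullback (λ ys → Q (g ys)) w
    iff w = mk⇔ (λ { ((zs , a′ , s′) , h) → let (ys , a) = dom⇒Applies h in
                       ys , a , subst Q (Applies-functional (subst (λ z → Applies z zs) (chunks-regroup w) a′) (Applies-natural g nat a)) s′ })
                (λ { (ys , a , s) → (g ys , subst (λ z → Applies z (g ys)) (sym (chunks-regroup w)) (Applies-natural g nat a) , s) , Applies⇒dom a })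

  chunks-++ : ∀ {k} (u : Vec A p) (w : Vec A (k * p)) → chunks (suc k) (u ++ w) ≡ u ∷ chunks k w
  chunks-++ {k} u w = cong₂ _∷_ (take-++ u w) (cong (chunks k) (drop-++ u w))

  tr-∃ : ∀ {k} {Q : Vec B (suc k) → Set} → Transferable Q → Transferable (λ ys → Σ B λ b → Q (b ∷ ys))
  tr-∃ {k} {Q} D = def-⇔ iff (def-∃Vec p D)
    where
    iff : ∀ w → (Σ (Vec A p) λ u → Pullback Q (u ++ w)) ⇔ Pullback (λ ys → Σ B λ b → Q (b ∷ ys)) w
    iff w = mk⇔ (λ { (u , (b ∷ ys) , a′ , s′) → ys , proj₂ (Applies-∷⁻¹ (subst (λ z → Applies z (b ∷ ys)) (chunks-++ u w) a′)) , b , s′ })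
                (λ { (ys , a , b , s) → let (x , d , e) = surj α b in
                       x , (b ∷ ys) , subst (λ z → Applies z (b ∷ ys)) (sym (chunks-++ x w)) (Applies-∷ (d , e) a) , s })

  tr-∃Vec : ∀ j {k} {Q : Vec B (j + k) → Set} → Transferable Q → Transferable (λ ys → Σ (Vec B j) λ u → Q (u ++ ys))
  tr-∃Vec zero D = tr-⇔ (λ v → mk⇔ (λ a → [] , a) (λ { ([] , a) → a })) D
  tr-∃Vec (suc j) {Q = Q} D = tr-⇔ (λ v → mk⇔ (λ { (u , x , a) → (x ∷ u) , a }) (λ { ((x ∷ u) , a) → u , x , a }))
    (tr-∃Vec j {Q = λ w → Σ B λ x → Q (x ∷ w)} (tr-∃ D))

  tr-EqRel : Transferable {2} EqRel
  tr-EqRel = tr-pullθ {Q = EqRel} (eqDef α)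

  open Language K

  TermGraph : ∀ {n} → Term {K} n → Vec B (suc n) → Set
  TermGraph t w = head w ≡ evalT 𝔅 t (tail w)

  TermsGraph : ∀ {n k} → Vec (Term {K} n) k → Vec B (k + n) → Set
  TermsGraph {k = k} ts w = take k w ≡ evalTs 𝔅 ts (drop k w)

  split⇔ : ∀ j {k} (Q : Vec B j → Vec B k → Set) v → (Σ (Vec B j) λ u → Q (take j (u ++ v)) (drop j (u ++ v))) ⇔ (Σ (Vec B j) λ u → Q u v)
  split⇔ j Q v = mk⇔ (λ { (u , q) → u , subst₂ Q (take-++ u v) (drop-++ u v) q })
                     (λ { (u , q) → u , subst₂ Q (sym (take-++ u v)) (sym (drop-++ u v)) q })

  mutual
    tr-term : ∀ {n} (t : Term {K} n) → Transferable (TermGraph t)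
    tr-term {n} (var i) = tr-natural g nat tr-EqRel
      where
      g : ∀ {X : Set} → Vec X (suc n) → Vec X 2
      g w = head w ∷ lookup (tail w) i ∷ []
      nat : Natural g
      nat f (x ∷ v) = cong (λ z → f x ∷ z ∷ []) (lookup-map i f v)
    tr-term {n} (app f ts) = tr-⇔ (λ w → mk⇔ (λ { (u , gr , e) → trans gr (cong (Structure.fun 𝔅 f) e) })
                                           (λ e → evalTs 𝔅 ts (tail w) , e , refl))
                                (tr-⇔ (split⇔ k Spec) (tr-∃Vec k (tr-∧ tr-graph tr-args)))
      where
      k = farity f
      Spec : Vec B k → Vec B (suc n) → Set
      Spec u w = graph 𝔅 f (head w ∷ u) × u ≡ evalTs 𝔅 ts (tail w)
      graphArgs : ∀ {X : Set} → Vec X (k + suc n) → Vec X (suc k)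
      graphArgs w = head (drop k w) ∷ take k w
      graphArgs-natural : Natural graphArgs
      graphArgs-natural h w = cong₂ _∷_ (trans (cong head (drop-map h k w)) (hd h (drop k w))) (take-map h k w)
        where
        hd : ∀ {X Y : Set} {m} (h : X → Y) (v : Vec X (suc m)) → head (map h v) ≡ h (head v)
        hd h (x ∷ v) = refl
      tr-graph : Transferable (λ w → graph 𝔅 f (graphArgs w))
      tr-graph = tr-natural graphArgs graphArgs-natural {Q = graph 𝔅 f} (tr-pullθ {Q = graph 𝔅 f} (funDef α f))
      termArgs : ∀ {X : Set} → Vec X (k + suc n) → Vec X (k + n)
      termArgs w = take k w ++ tail (drop k w)
      termArgs-natural : Natural termArgs
      termArgs-natural h w = trans (cong₂ _++_ (take-map h k w) (trans (cong tail (drop-map h k w)) (tl h (drop k w)))) (sym (map-++ h (take k w) (tail (drop k w))))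
        where
        tl : ∀ {X Y : Set} {m} (h : X → Y) (v : Vec X (suc m)) → tail (map h v) ≡ map h (tail v)
        tl h (x ∷ v) = refl
      tr-args : Transferable (λ w → take k w ≡ evalTs 𝔅 ts (tail (drop k w)))
      tr-args = tr-⇔ (λ w → mk⇔ (subst₂ (λ a b → a ≡ evalTs 𝔅 ts b) (take-++ (take k w) (tail (drop k w))) (drop-++ (take k w) (tail (drop k w))))
                            (subst₂ (λ a b → a ≡ evalTs 𝔅 ts b) (sym (take-++ (take k w) (tail (drop k w)))) (sym (drop-++ (take k w) (tail (drop k w))))))
                 (tr-natural termArgs termArgs-natural (tr-terms ts))

    tr-terms : ∀ {n k} (ts : Vec (Term {K} n) k) → Transferable (TermsGraph ts)
    tr-terms [] = tr-⇔ (λ w → mk⇔ (λ _ → refl) (λ _ → tt)) tr-⊤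
    tr-terms {n} {suc k} (t ∷ ts) = tr-⇔ (λ { (x ∷ w) → ×⇔∷≡∷ }) (tr-∧ (tr-natural headDrop headDrop-natural (tr-term t)) (tr-natural tail tail-natural (tr-terms ts)))
      where
      headDrop : ∀ {X : Set} → Vec X (suc k + n) → Vec X (suc n)
      headDrop w = head w ∷ drop (suc k) w
      headDrop-natural : Natural headDrop
      headDrop-natural f (x ∷ w) = cong (f x ∷_) (drop-map f k w)
      tail-natural : Natural (λ {X} (w : Vec X (suc k + n)) → tail w)
      tail-natural f (x ∷ w) = refl

  tr-Sat : ∀ {n} (φ : PEFormula {K} n) → Transferable (Sat 𝔅 φ)
  tr-Sat (s ≐ t) = tr-⇔ (λ ys → mk⇔ (λ { (b , e1 , e2) → trans (sym e1) e2 }) (λ e → evalT 𝔅 s ys , refl , e))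
                        (tr-∃ (tr-∧ (tr-term s) (tr-term t)))
  tr-Sat {n} (relA R ts) = tr-⇔ (λ ys → mk⇔ (λ { (u , r , e) → subst (rel 𝔅 R) e r }) (λ r → evalTs 𝔅 ts ys , r , refl))
                                (tr-⇔ (split⇔ k (λ u v → rel 𝔅 R u × u ≡ evalTs 𝔅 ts v)) (tr-∃Vec k (tr-∧ tr-rel (tr-terms ts))))
    where
    k = rarity R
    open Structure using (rel)
    tr-rel : Transferable (λ w → rel 𝔅 R (take k w))
    tr-rel = tr-natural (λ w → take k w) (λ f w → take-map f k w) {Q = rel 𝔅 R} (tr-pullθ {Q = rel 𝔅 R} (relDef α R))
  tr-Sat (φ ∧ ψ) = tr-∧ (tr-Sat φ) (tr-Sat ψ)
  tr-Sat (φ ∨ ψ) = tr-∨ (tr-Sat φ) (tr-Sat ψ)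
  tr-Sat (ex φ) = tr-∃ (tr-Sat φ)

  transfer : ∀ {k} {Y : Vec B k → Set} → PEDefinable 𝔅 Y → PEDefinable 𝔄 (pullθ 𝔄 𝔅 (θ α) Y)
  transfer {Y = Y} (φ , h) = def-⇔ (λ w → mk⇔ (from (pullθ⇔Pullback Y w)) (to (pullθ⇔Pullback Y w)))
                                    (tr-⇔ (λ v → mk⇔ (from (h v)) (to (h v))) (tr-Sat φ))

-- Definability through Γ

lookup-extensionality : ∀ {X : Set} {n} (xs ys : Vec X n) → (∀ i → lookup xs i ≡ lookup ys i) → xs ≡ ys
lookup-extensionality xs ys same = trans (sym (tabulate∘lookup xs)) (trans (tabulate-cong same) (tabulate∘lookup ys))

module DefinableViaΓ {L₁ L₂ : Language} {𝔐₁ : Structure L₁} {𝔐₂ : Structure L₂}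
                     (θ₁ : PEInterpretation 𝔐₁ 𝔐₂) (θ₂ : PEInterpretation 𝔐₂ 𝔐₁) (a₀ : Structure.Carrier 𝔐₁)
                     {r : ℕ} (X : Vec (Structure.Carrier 𝔐₁) r → Set) where
  private
    M₁ = Structure.Carrier 𝔐₁
    M₂ = Structure.Carrier 𝔐₂
    r₁ = rank θ₁
    r₂ = rank θ₂
  module A₁ = Application θ₁
  module A₂ = Application θ₂
  open Definability 𝔐₁

  n = (r * r₂) * r₁

  θ₂*X : Vec M₂ (r * r₂) → Set
  θ₂*X = pullθ 𝔐₂ 𝔐₁ (θ θ₂) X

  θ₁*θ₂*X : Vec M₁ n → Set
  θ₁*θ₂*X = pullθ 𝔐₁ 𝔐₂ (θ θ₁) θ₂*X

  Γ : Vec M₁ (suc (r₂ * r₁)) → Set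
  Γ = GammaComp θ₁ θ₂

  block : ∀ {V : Set} → Fin r → Vec V n → Vec V (r₂ * r₁)
  block i u = concat (lookup (chunks r (chunks (r * r₂) u)) i)

  block-natural : ∀ i {V W : Set} (f : V → W) (u : Vec V n) → block i (map f u) ≡ map f (block i u)
  block-natural i f u = begin
    concat (lookup (chunks r (chunks (r * r₂) (map f u))) i)          ≡⟨ cong (λ z → concat (lookup (chunks r z) i)) (sym (map-chunks (r * r₂) f u)) ⟩
    concat (lookup (chunks r (map (map f) (chunks (r * r₂) u))) i)    ≡⟨ cong (λ z → concat (lookup z i)) (sym (map-chunks r (map f) (chunks (r * r₂) u))) ⟩
    concat (lookup (map (map (map f)) (chunks r (chunks (r * r₂) u))) i) ≡⟨ cong concat (lookup-map i (map (map f)) (chunks r (chunks (r * r₂) u))) ⟩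
    concat (map (map f) (lookup (chunks r (chunks (r * r₂) u)) i))    ≡⟨ sym (map-concat f (lookup (chunks r (chunks (r * r₂) u)) i)) ⟩
    map f (block i u)                                                  ∎
    where open ≡-Reasoning

  chunks-block : ∀ i (u : Vec M₁ n) → chunks r₂ (block i u) ≡ lookup (chunks r (chunks (r * r₂) u)) i
  chunks-block i u = chunks-concat r₂ (lookup (chunks r (chunks (r * r₂) u)) i)

  Witness : Vec M₁ n → Vec M₁ r → Set
  Witness u xs = θ₁*θ₂*X u × (∀ i → Γ (lookup xs i ∷ block i u))

  ΓArgs : Fin r → ∀ {V : Set} → Vec V (n + r) → Vec V (suc (r₂ * r₁))
  ΓArgs i w = lookup (drop n w) i ∷ block i (take n w)

  ΓArgs-natural : ∀ i → Natural (ΓArgs i)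
  ΓArgs-natural i f w = cong₂ _∷_ (trans (cong (λ z → lookup z i) (drop-map f n w)) (lookup-map i f (drop n w)))
                                  (trans (cong (block i) (take-map f n w)) (block-natural i f (take n w)))

  witness-definable : PEDefinable 𝔐₁ θ₁*θ₂*X → PEDefinable 𝔐₁ Γ → PEDefinable 𝔐₁ (λ xs → Σ (Vec M₁ n) λ u → Witness u xs)
  witness-definable θ₁*θ₂*X-def Γ-def =
    def-⇔ (λ xs → mk⇔ (λ { (u , w) → u , subst₂ Witness (take-++ u xs) (drop-++ u xs) w })
                      (λ { (u , w) → u , subst₂ Witness (sym (take-++ u xs)) (sym (drop-++ u xs)) w }))
          (def-∃Vec n {X = λ w → Witness (take n w) (drop n w)}
            (def-∧ (def-natural (λ w → take n w) (λ f w → take-map f n w) θ₁*θ₂*X-def)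
                   (def-∀Fin a₀ _ (λ i → def-natural (ΓArgs i) (ΓArgs-natural i) Γ-def))))

  CodeOf : Vec M₁ r → Fin r → Vec M₂ r₂ → Set
  CodeOf xs i ys = Σ (dom θ₂ ys) λ d → lookup xs i ≡ θ θ₂ ys d

  witness⇒X : ∀ xs → (Σ (Vec M₁ n) λ u → Witness u xs) → X xs
  witness⇒X xs (u , u∈θ₁*θ₂*X , codes) with to (A₁.pullθ⇔Pullback θ₂*X u) u∈θ₁*θ₂*X
  ... | zs , θ₁u≡zs , zs∈θ₂*X with to (A₂.pullθ⇔Pullback X zs) zs∈θ₂*X
  ... | xs′ , θ₂zs≡xs′ , X-xs′ = subst X (sym (lookup-extensionality xs xs′ same)) X-xs′
    where
    same : ∀ i → lookup xs i ≡ lookup xs′ i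
    same i with to (A₁.pullθ⇔Pullback (CodeOf xs i) (block i u)) (codes i)
    ... | ys , θ₁block≡ys , d , xᵢ≡θ₂ys with A₂.Applies-lookup θ₂zs≡xs′ i
    ... | d′ , θ₂zᵢ≡x′ᵢ = trans xᵢ≡θ₂ys (trans (θ-cong θ₂ d d′ ys≡zᵢ) θ₂zᵢ≡x′ᵢ)
      where
      ys≡zᵢ : ys ≡ lookup (chunks r zs) i
      ys≡zᵢ = A₁.Applies-functional (subst (λ w → A₁.Applies w ys) (chunks-block i u) θ₁block≡ys)
                                    (A₁.Applies-natural (λ v → lookup (chunks r v) i) (lookup-chunks-natural r i) θ₁u≡zs)

  X⇒witness : ∀ xs → X xs → Σ (Vec M₁ n) λ u → Witness u xs
  X⇒witness xs X-xs with A₂.Applies-surjective xs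
  ... | yss , θ₂yss≡xs with A₁.Applies-surjective (concat yss)
  ... | bs , θ₁bs≡yss = concat bs , u∈θ₁*θ₂*X , codes
    where
    θ₁u≡zs : A₁.Applies (chunks (r * r₂) (concat bs)) (concat yss)
    θ₁u≡zs = subst (λ w → A₁.Applies w (concat yss)) (sym (chunks-concat (r * r₂) bs)) θ₁bs≡yss
    θ₂zs≡xs : A₂.Applies (chunks r (concat yss)) xs
    θ₂zs≡xs = subst (λ w → A₂.Applies w xs) (sym (chunks-concat r yss)) θ₂yss≡xs
    u∈θ₁*θ₂*X : θ₁*θ₂*X (concat bs)
    u∈θ₁*θ₂*X = from (A₁.pullθ⇔Pullback θ₂*X (concat bs))
                     (concat yss , θ₁u≡zs , from (A₂.pullθ⇔Pullback X (concat yss)) (xs , θ₂zs≡xs , X-xs))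
    codes : ∀ i → Γ (lookup xs i ∷ block i (concat bs))
    codes i with A₂.Applies-lookup θ₂yss≡xs i
    ... | d , θ₂yᵢ≡xᵢ = from (A₁.pullθ⇔Pullback (CodeOf xs i) (block i (concat bs)))
      (lookup yss i ,
       subst₂ A₁.Applies (sym (chunks-block i (concat bs))) (cong (λ w → lookup w i) (chunks-concat r yss))
              (A₁.Applies-natural (λ v → lookup (chunks r v) i) (lookup-chunks-natural r i) θ₁u≡zs) ,
       d , sym θ₂yᵢ≡xᵢ)

  X-definable : PEDefinable 𝔐₁ θ₁*θ₂*X → PEDefinable 𝔐₁ Γ → PEDefinable 𝔐₁ X
  X-definable θ₁*θ₂*X-def Γ-def = def-⇔ (λ xs → mk⇔ (witness⇒X xs) (X⇒witness xs)) (witness-definable θ₁*θ₂*X-def Γ-def)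

-- The bi-interpretation criterion

Γ-totallyListable : ∀ {L K} {𝔄 : Structure L} {𝔅 : Structure K} → (∀ π γ → EquivPres 𝔄 π γ) → Structure.Carrier 𝔅 →
                    (α : PEInterpretation 𝔄 𝔅) (β : PEInterpretation 𝔅 𝔄) → TotallyListable 𝔄 (GammaComp α β)
Γ-totallyListable unique b₀ α β π = ΓListable.Γ-listable _ _ unique b₀ α β π

pullθ-totallyListable : ∀ {L K} {𝔄 : Structure L} {𝔅 : Structure K} (α : PEInterpretation 𝔄 𝔅) → Structure.Carrier 𝔅 →
                        ∀ {r} {X : Vec (Structure.Carrier 𝔅) r → Set} → TotallyListable 𝔅 X → TotallyListable 𝔄 (pullθ 𝔄 𝔅 (θ α) X)
pullθ-totallyListable α b₀ {X = X} X-total π = PullbackListable.Y-listable _ _ π α b₀ X X-total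

Γ-definable⇒DPRM : ∀ {L₁ L₂} {𝔐₁ : Structure L₁} {𝔐₂ : Structure L₂} → Structure.Carrier 𝔐₁ → DPRM 𝔐₂ →
                   (θ₁ : PEInterpretation 𝔐₁ 𝔐₂) (θ₂ : PEInterpretation 𝔐₂ 𝔐₁) → PEDefinable 𝔐₁ (GammaComp θ₁ θ₂) → DPRM 𝔐₁
Γ-definable⇒DPRM {𝔐₁ = 𝔐₁} {𝔐₂} a₀ dprm₂ θ₁ θ₂ Γ-def r X X-total =
  DefinableViaΓ.X-definable θ₁ θ₂ a₀ X (Transfer.transfer 𝔐₁ 𝔐₂ θ₁ a₀ θ₂*X-def) Γ-def
  where
  θ₂*X-def : PEDefinable 𝔐₂ (pullθ 𝔐₂ 𝔐₁ (θ θ₂) X)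
  θ₂*X-def = dprm₂ _ _ (pullθ-totallyListable θ₂ a₀ {X = X} X-total)

theorem4p8 : {L₁ L₂ : Language} (𝔐₁ : Structure L₁) (𝔐₂ : Structure L₂) →
    UniquelyListable 𝔐₁ → UniquelyListable 𝔐₂ → DPRM 𝔐₂ →
    (θ₁ : PEInterpretation 𝔐₁ 𝔐₂) (θ₂ : PEInterpretation 𝔐₂ 𝔐₁) →
    (PEBiInterpretation θ₁ θ₂ ⇔ PEDefinable 𝔐₁ (GammaComp θ₁ θ₂))
    × (PEDefinable 𝔐₁ (GammaComp θ₁ θ₂) ⇔ DPRM 𝔐₁)
theorem4p8 𝔐₁ 𝔐₂ (π₁ , unique₁) (π₂ , unique₂) dprm₂ θ₁ θ₂ =
  mk⇔ proj₂ (λ Γ₁-def → dprm₂ _ _ (Γ-totallyListable unique₂ a₀ θ₂ θ₁) , Γ₁-def) ,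
  mk⇔ (Γ-definable⇒DPRM a₀ dprm₂ θ₁ θ₂) (λ dprm₁ → dprm₁ _ _ (Γ-totallyListable unique₁ b₀ θ₁ θ₂))
  where
  -- listable presentations are onto, so both carriers are inhabited
  a₀ = ρ π₁ 0
  b₀ = ρ π₂ 0
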